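{- Let $p$ be a prime and let $f(x)=ax^{p^m}+ph(x)+b\in\mathbb{Q}[x]$, where $m\ge1$, $\nu_p(a)=\nu_p(b)=0$, $h\in\mathbb{Q}[x]$, $\deg(h)<p^m$ and $\nu_p(h)\ge0$. Assume that $f$ is eventually $p$-type. Then the least integer $n>1$ such that $f^n$ is $p$-type is: (a) $n=p$ if $a\equiv1\pmod p$; (b) $n=\operatorname{ord}_p(a)$ otherwise.
   Context: $\nu_p$ denotes the $p$-adic valuation on $\mathbb{Q}$; for $h=\sum h_ix^i\in\mathbb{Q}[x]$, $\nu_p(h)=\min_i\nu_p(h_i)$. A polynomial $g(x)=c_dx^d+\dots+c_0\in\mathbb{Q}[x]$ of degree $d$ is $p$-type if $\nu_p(c_d)=0$ and $\nu_p(c_i)\ge1$ for $0\le i\le d-1$. $f$ is eventually $p$-type if the $n$-fold composition $f^n$ is $p$-type for some $n\ge1$. For $a\in\mathbb{Q}$ with $\nu_p(a)=0$, $\operatorname{ord}_p(a)$ is the multiplicative order of $a$ modulo $p$. -}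

module Defs where

open import Data.Nat as ℕ using (ℕ; zero; suc; _<_; _≤_)
open import Data.Nat.Divisibility using (_∣_)
open import Data.Integer as ℤ using (ℤ; +_; ∣_∣)
open import Data.Rational as ℚ using (ℚ; ↥_; ↧ₙ_; 0ℚ; 1ℚ; _+_; _*_; _-_; _/_)
open import Data.List using (List; []; _∷_; map; foldr)
open import Data.Product using (_×_; ∃; ∃-syntax)
open import Data.Sum using (_⊎_)
open import Relation.Nullary using (¬_)
open import Relation.Binary.PropositionalEquality using (_≡_)

-- p^e exactly divides n (n ≠ 0 is forced, since every p^k divides 0).
ExactPow : ℕ → ℕ → ℕ → Set
ExactPow p e n = (p ℕ.^ e ∣ n) × ¬ (p ℕ.^ suc e ∣ n)

-- Val p c e : ν_p(c) = e, for c ≠ 0 (never holds for c = 0).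
-- With c = r/s in lowest terms, ν_p(c) = ν_p(r) - ν_p(s).
Val : ℕ → ℚ → ℤ → Set
Val p c e = ∃[ e₁ ] ∃[ e₂ ] (ExactPow p e₁ ∣ ↥ c ∣ × ExactPow p e₂ (↧ₙ c) × e ≡ (+ e₁) ℤ.- (+ e₂))

ValGE : ℕ → ℤ → ℚ → Set
ValGE p k c = c ≡ 0ℚ ⊎ ∃[ e ] (Val p c e × k ℤ.≤ e)

-- Polynomials over ℚ as coefficient lists, lowest degree first
-- (trailing zeros allowed).

Poly : Set
Poly = List ℚ

coeff : Poly → ℕ → ℚ
coeff []       _       = 0ℚ
coeff (c ∷ _)  zero    = c
coeff (_ ∷ cs) (suc i) = coeff cs i

padd : Poly → Poly → Poly
padd []       q        = q
padd (a ∷ p)  []       = a ∷ p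
padd (a ∷ p)  (b ∷ q)  = (a + b) ∷ padd p q

pscale : ℚ → Poly → Poly
pscale c = map (c *_)

pmul : Poly → Poly → Poly
pmul []      q = []
pmul (a ∷ p) q = padd (pscale a q) (0ℚ ∷ pmul p q)

pconst : ℚ → Poly
pconst c = c ∷ []

pmono : ℚ → ℕ → Poly
pmono c zero    = c ∷ []
pmono c (suc k) = 0ℚ ∷ pmono c k

-- composition: pcomp g f = g ∘ f = g(f(x))  (Horner)
pcomp : Poly → Poly → Poly
pcomp g f = foldr (λ c acc → padd (pconst c) (pmul f acc)) [] g

piter : ℕ → Poly → Poly
piter zero    f = 0ℚ ∷ 1ℚ ∷ []
piter (suc n) f = pcomp f (piter n f)

HasDegree : Poly → ℕ → Set
HasDegree g d = ¬ (coeff g d ≡ 0ℚ) × (∀ i → d < i → coeff g i ≡ 0ℚ)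

PType : ℕ → Poly → Set
PType p g = ∃[ d ] (HasDegree g d × Val p (coeff g d) (+ 0)
                    × (∀ i → i < d → ValGE p (+ 1) (coeff g i)))

EventuallyPType : ℕ → Poly → Set
EventuallyPType p f = ∃[ n ] (1 ≤ n × PType p (piter n f))

PolyValGE : ℕ → ℤ → Poly → Set
PolyValGE p k h = ∀ i → ValGE p k (coeff h i)

-- deg h < N (the zero polynomial included)
DegLT : Poly → ℕ → Set
DegLT h N = ∀ i → N ≤ i → coeff h i ≡ 0ℚ

_^ℚ_ : ℚ → ℕ → ℚ
a ^ℚ zero  = 1ℚ
a ^ℚ suc k = a * (a ^ℚ k)

CongModP : ℕ → ℚ → ℚ → Set
CongModP p a b = ValGE p (+ 1) (a - b)

IsOrd : ℕ → ℚ → ℕ → Set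
IsOrd p a k = 1 ≤ k × CongModP p (a ^ℚ k) 1ℚ
            × (∀ j → 1 ≤ j → j < k → ¬ CongModP p (a ^ℚ j) 1ℚ)

IsLeastPTypeIter : ℕ → Poly → ℕ → Set
IsLeastPTypeIter p f n = 1 < n × PType p (piter n f)
                       × (∀ j → 1 < j → j < n → ¬ PType p (piter j f))

fPoly : ℕ → ℕ → ℚ → Poly → ℚ → Poly
fPoly p m a h b = padd (pmono a (p ℕ.^ m)) (padd (pscale ((+ p) / 1) h) (pconst b))

-- Reduce modulo p. Every binomial coefficient C(pᵐ, j) with 0 < j < pᵐ is divisible by p, and
-- B^(pᵐ) ≡ B (mod p) for p-integral B (Fermat), so composing f ≡ a x^(pᵐ) + b with a polynomial
-- g ≡ A xᴺ + B, A a p-adic unit, gives f ∘ g ≡ a A^(pᵐ) x^(pᵐ N) + (a B + b). Hence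
-- fⁿ ≡ Aₙ x^(pᵐⁿ) + cₙ with c₀ = 0 and cₙ₊₁ ≡ a cₙ + b, that is cₙ ≡ b (1 + a + ⋯ + aⁿ⁻¹),
-- and fⁿ is p-type exactly when p ∣ cₙ. If a ≡ 1 this says p ∣ n; otherwise, multiplying
-- by the unit a − 1, it says aⁿ ≡ 1 (mod p).

module Submission where

open import Defs
open import Data.Nat as ℕ using (ℕ; zero; suc; z≤n; s≤s; _≤_; _^_; _!)
import Data.Nat.Properties as ℕP
import Data.Nat.DivMod as ℕDM
open import Data.Nat.Divisibility as ℕD using (divides)
open import Data.Nat.Primality using (Prime; euclidsLemma; prime⇒nonTrivial; prime⇒nonZero; prime⇒irreducible)
open import Data.Nat.Combinatorics using (_C_; nCn≡1; nCk+nC[k+1]≡[n+1]C[k+1])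
import Data.Nat.Tactic.RingSolver as ℕ-Solver
import Data.Nat.GCD as GCD
import Data.Nat.Coprimality as Coprime
open import Data.Nat.Induction using (<-rec)
open import Data.Integer as ℤ using (ℤ; +_; ∣_∣)
import Data.Integer.Properties as ℤP
import Data.Integer.Divisibility.Signed as ℤS
import Data.Integer.DivMod as ℤDM
import Data.Integer.Tactic.RingSolver as ℤ-Solver
open import Data.Rational as ℚ using (ℚ; mkℚ; 0ℚ; 1ℚ; _+_; _*_; _-_; -_; _/_; ↥_; ↧_; ↧ₙ_)
import Data.Rational.Properties as ℚP
open import Data.Fin as Fin using (Fin; fromℕ; inject₁)
import Data.Fin.Properties as FinP
open import Function using (_∘_)
open import Data.Maybe using (Maybe; nothing; just)
open import Data.List using ([]; _∷_)
open import Data.Product using (_×_; _,_; proj₁; proj₂; ∃; ∃-syntax)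
open import Data.Sum using (_⊎_; inj₁; inj₂)
open import Data.Empty using (⊥-elim)
open import Relation.Nullary using (¬_; yes; no)
open import Relation.Nullary.Decidable using (map′)
open import Relation.Unary using (Decidable)
open import Relation.Binary.PropositionalEquality
open import Relation.Binary.Bundles using (Setoid)
open import Relation.Binary.Definitions using (tri<; tri≈; tri>)
import Relation.Binary.Reasoning.Setoid as SetoidReasoning
open import Tactic.RingSolver using (solve-∀)
open import Algebra.Bundles using (CommutativeRing; CommutativeSemiring)
import Algebra.Properties.CommutativeSemiring.Binomial as CommutativeSemiringBinomial
import Algebra.Properties.Semiring.Exp as SemiringExp
import Algebra.Definitions.RawMonoid as RawMonoidDefs
import Algebra.Properties.Monoid.Sum as MonoidSum
open import Tactic.RingSolver.Core.AlmostCommutativeRing using (AlmostCommutativeRing; fromCommutativeRing)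

ℚ-ring : AlmostCommutativeRing _ _
ℚ-ring = fromCommutativeRing ℚP.+-*-commutativeRing 0≟
  where
  0≟ : (x : ℚ) → Maybe (0ℚ ≡ x)
  0≟ x with 0ℚ ℚ.≟ x
  ... | yes 0≡x = just 0≡x
  ... | no  _   = nothing

-- binom j l is (j + l) choose j, indexed so that Pascal's rule is structural.
binom : ℕ → ℕ → ℕ
binom zero    l       = 1
binom (suc j) zero    = 1
binom (suc j) (suc l) = binom j (suc l) ℕ.+ binom (suc j) l

binom-*-! : ∀ j l → binom j l ℕ.* (j ! ℕ.* l !) ≡ (j ℕ.+ l) !
binom-*-! zero    l       = trans (ℕP.*-identityˡ _) (ℕP.*-identityˡ _)
binom-*-! (suc j) zero    = trans (ℕP.*-identityˡ _) (trans (ℕP.*-identityʳ _) (cong _! (sym (ℕP.+-identityʳ (suc j)))))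
binom-*-! (suc j) (suc l) = begin
  (X ℕ.+ Y) ℕ.* (suc j ! ℕ.* suc l !)
    ≡⟨ distribute X Y (j !) (l !) j l ⟩
  suc j ℕ.* (X ℕ.* (j ! ℕ.* suc l !)) ℕ.+ suc l ℕ.* (Y ℕ.* (suc j ! ℕ.* l !))
    ≡⟨ cong₂ (λ u v → suc j ℕ.* u ℕ.+ suc l ℕ.* v) (binom-*-! j (suc l))
             (trans (binom-*-! (suc j) l) (cong _! (sym (ℕP.+-suc j l)))) ⟩
  suc j ℕ.* (j ℕ.+ suc l) ! ℕ.+ suc l ℕ.* (j ℕ.+ suc l) !
    ≡⟨ ℕP.*-distribʳ-+ ((j ℕ.+ suc l) !) (suc j) (suc l) ⟨
  (suc j ℕ.+ suc l) !
    ∎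
  where
  open ≡-Reasoning
  X Y : ℕ
  X = binom j (suc l)
  Y = binom (suc j) l
  distribute : ∀ X Y F G j l →
    (X ℕ.+ Y) ℕ.* ((suc j ℕ.* F) ℕ.* (suc l ℕ.* G))
      ≡ suc j ℕ.* (X ℕ.* (F ℕ.* (suc l ℕ.* G))) ℕ.+ suc l ℕ.* (Y ℕ.* ((suc j ℕ.* F) ℕ.* G))
  distribute = ℕ-Solver.solve-∀

binom-absorb : ∀ j l → suc j ℕ.* binom (suc j) l ≡ (suc j ℕ.+ l) ℕ.* binom j l
binom-absorb j l = ℕP.*-cancelʳ-≡ _ _ (j ! ℕ.* l !) {{ℕP._!*_!≢0 j l}} (begin
  suc j ℕ.* binom (suc j) l ℕ.* (j ! ℕ.* l !)   ≡⟨ shuffle (suc j) (binom (suc j) l) (j !) (l !) ⟩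
  binom (suc j) l ℕ.* (suc j ! ℕ.* l !)          ≡⟨ binom-*-! (suc j) l ⟩
  (suc j ℕ.+ l) !                                ≡⟨ cong ((suc j ℕ.+ l) ℕ.*_) (binom-*-! j l) ⟨
  (suc j ℕ.+ l) ℕ.* (binom j l ℕ.* (j ! ℕ.* l !)) ≡⟨ ℕP.*-assoc (suc j ℕ.+ l) (binom j l) _ ⟨
  (suc j ℕ.+ l) ℕ.* binom j l ℕ.* (j ! ℕ.* l !)  ∎)
  where
  open ≡-Reasoning
  shuffle : ∀ a B F G → (a ℕ.* B) ℕ.* (F ℕ.* G) ≡ B ℕ.* ((a ℕ.* F) ℕ.* G)
  shuffle = ℕ-Solver.solve-∀

binom≡C : ∀ j l → binom j l ≡ (j ℕ.+ l) C j
binom≡C zero    l       = refl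
binom≡C (suc j) zero    = trans (sym (nCn≡1 (suc j))) (cong (_C suc j) (sym (ℕP.+-identityʳ (suc j))))
binom≡C (suc j) (suc l) =
  trans (cong₂ ℕ._+_ (binom≡C j (suc l)) (trans (binom≡C (suc j) l) (cong (_C suc j) (sym (ℕP.+-suc j l)))))
        (nCk+nC[k+1]≡[n+1]C[k+1] (j ℕ.+ suc l) j)

toℚ : ℕ → ℚ
toℚ zero    = 0ℚ
toℚ (suc n) = 1ℚ + toℚ n

toℚ-+ : ∀ m n → toℚ (m ℕ.+ n) ≡ toℚ m + toℚ n
toℚ-+ zero    n = sym (ℚP.+-identityˡ (toℚ n))
toℚ-+ (suc m) n = trans (cong (λ z → 1ℚ + z) (toℚ-+ m n)) (sym (ℚP.+-assoc 1ℚ (toℚ m) (toℚ n)))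

toℚ-fraction : ∀ n → ↥ toℚ n ≡ + n × ↧ₙ toℚ n ≡ 1
toℚ-fraction zero    = refl , refl
toℚ-fraction (suc n) = ↥≡ , ↧≡
  where
  open ≡-Reasoning
  x : ℚ
  x = toℚ n
  ih : ↥ x ≡ + n × ↧ₙ x ≡ 1
  ih = toℚ-fraction n
  g : ℕ
  g = GCD.gcd ∣ + 1 ℤ.* ↧ x ℤ.+ ↥ x ℤ.* + 1 ∣ ∣ + 1 ℤ.* ↧ x ∣
  ↧*g≡1 : ↧ₙ (1ℚ + x) ℕ.* g ≡ 1
  ↧*g≡1 = trans (sym (ℤP.abs-* (↧ (1ℚ + x)) (+ g)))
                (trans (cong ∣_∣ (ℚP.↧-+ 1ℚ x)) (cong (λ d → ∣ + 1 ℤ.* + d ∣) (proj₂ ih)))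
  ↧≡ : ↧ₙ (1ℚ + x) ≡ 1
  ↧≡ = ℕP.m*n≡1⇒m≡1 (↧ₙ (1ℚ + x)) g ↧*g≡1
  ↥≡ : ↥ (1ℚ + x) ≡ + suc n
  ↥≡ = begin
    ↥ (1ℚ + x)                     ≡⟨ ℤP.*-identityʳ _ ⟨
    ↥ (1ℚ + x) ℤ.* + 1            ≡⟨ cong (λ k → ↥ (1ℚ + x) ℤ.* + k) (ℕP.m*n≡1⇒n≡1 (↧ₙ (1ℚ + x)) g ↧*g≡1) ⟨
    ↥ (1ℚ + x) ℤ.* + g            ≡⟨ ℚP.↥-+ 1ℚ x ⟩
    + 1 ℤ.* ↧ x ℤ.+ ↥ x ℤ.* + 1   ≡⟨ cong₂ (λ d k → + 1 ℤ.* + d ℤ.+ k ℤ.* + 1) (proj₂ ih) (proj₁ ih) ⟩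
    + 1 ℤ.+ + n ℤ.* + 1           ≡⟨ cong (λ k → + 1 ℤ.+ k) (ℤP.*-identityʳ (+ n)) ⟩
    + suc n                        ∎

^ℚ-distribˡ-+-* : ∀ x m n → x ^ℚ (m ℕ.+ n) ≡ x ^ℚ m * x ^ℚ n
^ℚ-distribˡ-+-* x zero    n = sym (ℚP.*-identityˡ _)
^ℚ-distribˡ-+-* x (suc m) n = trans (cong (x *_) (^ℚ-distribˡ-+-* x m n)) (sym (ℚP.*-assoc x _ _))

^ℚ-distribʳ-* : ∀ x y n → (x * y) ^ℚ n ≡ x ^ℚ n * y ^ℚ n
^ℚ-distribʳ-* x y zero    = refl
^ℚ-distribʳ-* x y (suc n) = trans (cong ((x * y) *_) (^ℚ-distribʳ-* x y n)) (interchange x y (x ^ℚ n) (y ^ℚ n))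
  where
  interchange : ∀ a b c d → (a * b) * (c * d) ≡ (a * c) * (b * d)
  interchange = solve-∀ ℚ-ring

1^ℚn≡1 : ∀ n → 1ℚ ^ℚ n ≡ 1ℚ
1^ℚn≡1 zero    = refl
1^ℚn≡1 (suc n) = trans (ℚP.*-identityˡ _) (1^ℚn≡1 n)

^ℚ-*-assoc : ∀ x m n → (x ^ℚ m) ^ℚ n ≡ x ^ℚ (m ℕ.* n)
^ℚ-*-assoc x zero    n = 1^ℚn≡1 n
^ℚ-*-assoc x (suc m) n = begin
  (x * x ^ℚ m) ^ℚ n          ≡⟨ ^ℚ-distribʳ-* x (x ^ℚ m) n ⟩
  x ^ℚ n * (x ^ℚ m) ^ℚ n     ≡⟨ cong (x ^ℚ n *_) (^ℚ-*-assoc x m n) ⟩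
  x ^ℚ n * x ^ℚ (m ℕ.* n)    ≡⟨ ^ℚ-distribˡ-+-* x n (m ℕ.* n) ⟨
  x ^ℚ (n ℕ.+ m ℕ.* n)       ∎
  where open ≡-Reasoning

geom : ℚ → ℕ → ℚ
geom x zero    = 0ℚ
geom x (suc n) = 1ℚ + x * geom x n

[x-1]*geom≡x^n-1 : ∀ x n → (x - 1ℚ) * geom x n ≡ x ^ℚ n - 1ℚ
[x-1]*geom≡x^n-1 x zero    = zero-case x
  where
  zero-case : ∀ x → (x - 1ℚ) * 0ℚ ≡ 1ℚ - 1ℚ
  zero-case = solve-∀ ℚ-ring
[x-1]*geom≡x^n-1 x (suc n) = begin
  (x - 1ℚ) * (1ℚ + x * geom x n)       ≡⟨ expand x (geom x n) ⟩
  (x - 1ℚ) + x * ((x - 1ℚ) * geom x n) ≡⟨ cong (λ y → (x - 1ℚ) + x * y) ([x-1]*geom≡x^n-1 x n) ⟩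
  (x - 1ℚ) + x * (x ^ℚ n - 1ℚ)         ≡⟨ collect x (x ^ℚ n) ⟩
  x * x ^ℚ n - 1ℚ                      ∎
  where
  open ≡-Reasoning
  expand : ∀ x g → (x - 1ℚ) * (1ℚ + x * g) ≡ (x - 1ℚ) + x * ((x - 1ℚ) * g)
  expand = solve-∀ ℚ-ring
  collect : ∀ x y → (x - 1ℚ) + x * (y - 1ℚ) ≡ x * y - 1ℚ
  collect = solve-∀ ℚ-ring

module _ {P : ℕ → Set} (P? : Decidable P) where

  LeastPositive : ℕ → Set
  LeastPositive k = 1 ≤ k × P k × (∀ j → 1 ≤ j → j ℕ.< k → ¬ P j)

  private
    search : ∀ n → ∃ LeastPositive ⊎ (∀ j → 1 ≤ j → j ≤ n → ¬ P j)
    search zero = inj₂ λ j 1≤j j≤0 _ → ℕP.<⇒≱ 1≤j j≤0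
    search (suc n) with search n
    ... | inj₁ found = inj₁ found
    ... | inj₂ none with P? (suc n)
    ...   | yes P[1+n] = inj₁ (suc n , s≤s z≤n , P[1+n] , λ j 1≤j j<1+n → none j 1≤j (ℕP.≤-pred j<1+n))
    ...   | no ¬P[1+n] = inj₂ below
      where
      below : ∀ j → 1 ≤ j → j ≤ suc n → ¬ P j
      below j 1≤j j≤1+n with j ℕ.≟ suc n
      ... | yes refl = ¬P[1+n]
      ... | no j≢1+n = none j 1≤j (ℕP.≤-pred (ℕP.≤∧≢⇒< j≤1+n j≢1+n))

  leastPositive : ∀ {n} → 1 ≤ n → P n → ∃ LeastPositive
  leastPositive {n} 1≤n Pn with search n
  ... | inj₁ found = found
  ... | inj₂ none  = ⊥-elim (none n 1≤n ℕP.≤-refl Pn)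

-- Coefficients of polynomial operations

coeff-padd : ∀ P Q i → coeff (padd P Q) i ≡ coeff P i + coeff Q i
coeff-padd []      Q       i       = sym (ℚP.+-identityˡ _)
coeff-padd (a ∷ P) []      i       = sym (ℚP.+-identityʳ _)
coeff-padd (a ∷ P) (b ∷ Q) zero    = refl
coeff-padd (a ∷ P) (b ∷ Q) (suc i) = coeff-padd P Q i

coeff-pscale : ∀ c P i → coeff (pscale c P) i ≡ c * coeff P i
coeff-pscale c []      i       = sym (ℚP.*-zeroʳ c)
coeff-pscale c (a ∷ P) zero    = refl
coeff-pscale c (a ∷ P) (suc i) = coeff-pscale c P i

coeff-pmul₀ : ∀ a P Q → coeff (pmul (a ∷ P) Q) 0 ≡ a * coeff Q 0
coeff-pmul₀ a P Q = trans (coeff-padd (pscale a Q) (0ℚ ∷ pmul P Q) 0)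
                          (trans (ℚP.+-identityʳ _) (coeff-pscale a Q 0))

coeff-pmul-suc : ∀ a P Q i → coeff (pmul (a ∷ P) Q) (suc i) ≡ a * coeff Q (suc i) + coeff (pmul P Q) i
coeff-pmul-suc a P Q i = trans (coeff-padd (pscale a Q) (0ℚ ∷ pmul P Q) (suc i))
                               (cong (_+ coeff (pmul P Q) i) (coeff-pscale a Q (suc i)))

coeff-pmono-≡ : ∀ c k → coeff (pmono c k) k ≡ c
coeff-pmono-≡ c zero    = refl
coeff-pmono-≡ c (suc k) = coeff-pmono-≡ c k

coeff-pmono-≢ : ∀ c k i → i ≢ k → coeff (pmono c k) i ≡ 0ℚ
coeff-pmono-≢ c zero    zero    i≢k = ⊥-elim (i≢k refl)
coeff-pmono-≢ c zero    (suc i) _   = refl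
coeff-pmono-≢ c (suc k) zero    _   = refl
coeff-pmono-≢ c (suc k) (suc i) i≢k = coeff-pmono-≢ c k i (λ i≡k → i≢k (cong suc i≡k))

coeff-pcomp₀ : ∀ c F g → coeff (pcomp (c ∷ F) g) 0 ≡ c + coeff (pmul g (pcomp F g)) 0
coeff-pcomp₀ c F g = coeff-padd (pconst c) (pmul g (pcomp F g)) 0

coeff-pcomp-suc : ∀ c F g i → coeff (pcomp (c ∷ F) g) (suc i) ≡ coeff (pmul g (pcomp F g)) (suc i)
coeff-pcomp-suc c F g i = trans (coeff-padd (pconst c) (pmul g (pcomp F g)) (suc i)) (ℚP.+-identityˡ _)

IsZero : Poly → Set
IsZero P = ∀ i → coeff P i ≡ 0ℚ

pmul-zeroˡ : ∀ P R → IsZero P → IsZero (pmul P R)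
pmul-zeroˡ []      R P≡0 i       = refl
pmul-zeroˡ (a ∷ P) R P≡0 zero    =
  trans (coeff-pmul₀ a P R) (trans (cong (_* coeff R 0) (P≡0 0)) (ℚP.*-zeroˡ (coeff R 0)))
pmul-zeroˡ (a ∷ P) R P≡0 (suc i) =
  trans (coeff-pmul-suc a P R i)
        (trans (cong₂ _+_ (trans (cong (_* coeff R (suc i)) (P≡0 0)) (ℚP.*-zeroˡ (coeff R (suc i))))
                          (pmul-zeroˡ P R (λ j → P≡0 (suc j)) i))
               (ℚP.+-identityˡ 0ℚ))

pmul-zeroʳ : ∀ P R → IsZero R → IsZero (pmul P R)
pmul-zeroʳ []      R R≡0 i       = refl
pmul-zeroʳ (a ∷ P) R R≡0 zero    =
  trans (coeff-pmul₀ a P R) (trans (cong (a *_) (R≡0 0)) (ℚP.*-zeroʳ a))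
pmul-zeroʳ (a ∷ P) R R≡0 (suc i) =
  trans (coeff-pmul-suc a P R i)
        (trans (cong₂ _+_ (trans (cong (a *_) (R≡0 (suc i))) (ℚP.*-zeroʳ a)) (pmul-zeroʳ P R R≡0 i))
               (ℚP.+-identityˡ 0ℚ))

pcomp-zeroˡ : ∀ F g → IsZero F → IsZero (pcomp F g)
pcomp-zeroˡ []      g F≡0 i       = refl
pcomp-zeroˡ (c ∷ F) g F≡0 zero    =
  trans (coeff-pcomp₀ c F g)
        (trans (cong₂ _+_ (F≡0 0) (pmul-zeroʳ g (pcomp F g) (pcomp-zeroˡ F g (λ j → F≡0 (suc j))) 0))
               (ℚP.+-identityˡ 0ℚ))
pcomp-zeroˡ (c ∷ F) g F≡0 (suc i) =
  trans (coeff-pcomp-suc c F g i) (pmul-zeroʳ g (pcomp F g) (pcomp-zeroˡ F g (λ j → F≡0 (suc j))) (suc i))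

DegLE : Poly → ℕ → Set
DegLE P N = DegLT P (suc N)

pmono-degLE : ∀ c k → DegLE (pmono c k) k
pmono-degLE c k i k<i = coeff-pmono-≢ c k i (λ i≡k → ℕP.<⇒≢ k<i (sym i≡k))

pmul-degLE : ∀ g R N M → DegLE g N → DegLE R M →
  DegLE (pmul g R) (N ℕ.+ M) × coeff (pmul g R) (N ℕ.+ M) ≡ coeff g N * coeff R M
pmul-degLE []      R N       M _     _     = (λ _ _ → refl) , sym (ℚP.*-zeroˡ (coeff R M))
pmul-degLE (c ∷ g) R zero    M g≤N   R≤M   = bound , leading
  where
  g≡0 : IsZero g
  g≡0 j = g≤N (suc j) (s≤s z≤n)
  bound : DegLE (pmul (c ∷ g) R) M
  bound (suc i) M<i =
    trans (coeff-pmul-suc c g R i)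
          (trans (cong₂ _+_ (trans (cong (c *_) (R≤M (suc i) M<i)) (ℚP.*-zeroʳ c)) (pmul-zeroˡ g R g≡0 i))
                 (ℚP.+-identityˡ 0ℚ))
  leading′ : ∀ M → coeff (pmul (c ∷ g) R) M ≡ c * coeff R M
  leading′ zero    = coeff-pmul₀ c g R
  leading′ (suc M) = trans (coeff-pmul-suc c g R M)
                           (trans (cong (λ z → c * coeff R (suc M) + z) (pmul-zeroˡ g R g≡0 M)) (ℚP.+-identityʳ _))
  leading : coeff (pmul (c ∷ g) R) M ≡ c * coeff R M
  leading = leading′ M
pmul-degLE (c ∷ g) R (suc N) M g≤1+N R≤M = bound , leading
  where
  ih : DegLE (pmul g R) (N ℕ.+ M) × coeff (pmul g R) (N ℕ.+ M) ≡ coeff g N * coeff R M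
  ih = pmul-degLE g R N M (λ i N<i → g≤1+N (suc i) (s≤s N<i)) R≤M
  bound : DegLE (pmul (c ∷ g) R) (suc N ℕ.+ M)
  bound (suc i) (s≤s N+M<i) =
    trans (coeff-pmul-suc c g R i)
          (trans (cong₂ _+_ (trans (cong (c *_) (R≤M (suc i) (ℕP.m<n⇒m<1+n (ℕP.≤-<-trans (ℕP.m≤n+m M N) N+M<i))))
                                   (ℚP.*-zeroʳ c))
                            (proj₁ ih i N+M<i))
                 (ℚP.+-identityˡ 0ℚ))
  leading : coeff (pmul (c ∷ g) R) (suc N ℕ.+ M) ≡ coeff g N * coeff R M
  leading =
    trans (coeff-pmul-suc c g R (N ℕ.+ M))
          (trans (cong₂ _+_ (trans (cong (c *_) (R≤M (suc (N ℕ.+ M)) (s≤s (ℕP.m≤n+m M N)))) (ℚP.*-zeroʳ c))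
                            (proj₂ ih))
                 (ℚP.+-identityˡ _))

pcomp-degLE : ∀ F D g N → DegLE F D → DegLE g (suc N) →
  DegLE (pcomp F g) (D ℕ.* suc N) × coeff (pcomp F g) (D ℕ.* suc N) ≡ coeff F D * coeff g (suc N) ^ℚ D
pcomp-degLE []      D       g N _     _     = (λ _ _ → refl) , sym (ℚP.*-zeroˡ (coeff g (suc N) ^ℚ D))
pcomp-degLE (c ∷ F) zero    g N F≤0   g≤1+N = bound , leading
  where
  rest≡0 : IsZero (pmul g (pcomp F g))
  rest≡0 = pmul-zeroʳ g (pcomp F g) (pcomp-zeroˡ F g (λ j → F≤0 (suc j) (s≤s z≤n)))
  bound : DegLE (pcomp (c ∷ F) g) 0
  bound (suc i) _ = trans (coeff-pcomp-suc c F g i) (rest≡0 (suc i))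
  leading : coeff (pcomp (c ∷ F) g) 0 ≡ c * 1ℚ
  leading = trans (coeff-pcomp₀ c F g)
                  (trans (cong (λ z → c + z) (rest≡0 0)) (trans (ℚP.+-identityʳ c) (sym (ℚP.*-identityʳ c))))
pcomp-degLE (c ∷ F) (suc D) g N F≤1+D g≤1+N = bound , leading
  where
  A : ℚ
  A = coeff g (suc N)
  ih : DegLE (pcomp F g) (D ℕ.* suc N) × coeff (pcomp F g) (D ℕ.* suc N) ≡ coeff F D * A ^ℚ D
  ih = pcomp-degLE F D g N (λ i D<i → F≤1+D (suc i) (s≤s D<i)) g≤1+N
  prod : DegLE (pmul g (pcomp F g)) (suc N ℕ.+ D ℕ.* suc N)
       × coeff (pmul g (pcomp F g)) (suc N ℕ.+ D ℕ.* suc N) ≡ A * coeff (pcomp F g) (D ℕ.* suc N)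
  prod = pmul-degLE g (pcomp F g) (suc N) (D ℕ.* suc N) g≤1+N (proj₁ ih)
  bound : DegLE (pcomp (c ∷ F) g) (suc D ℕ.* suc N)
  bound (suc i) lt = trans (coeff-pcomp-suc c F g i) (proj₁ prod (suc i) lt)
  leading : coeff (pcomp (c ∷ F) g) (suc D ℕ.* suc N) ≡ coeff F D * (A * A ^ℚ D)
  leading = trans (coeff-pcomp-suc c F g (N ℕ.+ D ℕ.* suc N))
                  (trans (proj₂ prod) (trans (cong (A *_) (proj₂ ih)) (swap A (coeff F D) (A ^ℚ D))))
    where
    swap : ∀ x y z → x * (y * z) ≡ y * (x * z)
    swap = solve-∀ ℚ-ring

coeff-pmul-padd : ∀ P Q R i → coeff (pmul (padd P Q) R) i ≡ coeff (pmul P R) i + coeff (pmul Q R) i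
coeff-pmul-padd []      Q       R i       = sym (ℚP.+-identityˡ _)
coeff-pmul-padd (a ∷ P) []      R i       = sym (ℚP.+-identityʳ _)
coeff-pmul-padd (a ∷ P) (b ∷ Q) R zero    =
  trans (coeff-pmul₀ (a + b) (padd P Q) R)
        (trans (ℚP.*-distribʳ-+ (coeff R 0) a b) (sym (cong₂ _+_ (coeff-pmul₀ a P R) (coeff-pmul₀ b Q R))))
coeff-pmul-padd (a ∷ P) (b ∷ Q) R (suc i) = begin
  coeff (pmul (a + b ∷ padd P Q) R) (suc i)
    ≡⟨ coeff-pmul-suc (a + b) (padd P Q) R i ⟩
  (a + b) * r + coeff (pmul (padd P Q) R) i
    ≡⟨ cong (λ z → (a + b) * r + z) (coeff-pmul-padd P Q R i) ⟩
  (a + b) * r + (coeff (pmul P R) i + coeff (pmul Q R) i)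
    ≡⟨ regroup a b r (coeff (pmul P R) i) (coeff (pmul Q R) i) ⟩
  (a * r + coeff (pmul P R) i) + (b * r + coeff (pmul Q R) i)
    ≡⟨ cong₂ _+_ (coeff-pmul-suc a P R i) (coeff-pmul-suc b Q R i) ⟨
  coeff (pmul (a ∷ P) R) (suc i) + coeff (pmul (b ∷ Q) R) (suc i)
    ∎
  where
  open ≡-Reasoning
  r : ℚ
  r = coeff R (suc i)
  regroup : ∀ a b r x y → (a + b) * r + (x + y) ≡ (a * r + x) + (b * r + y)
  regroup = solve-∀ ℚ-ring

coeff-pmul-pconst : ∀ B R i → coeff (pmul (pconst B) R) i ≡ B * coeff R i
coeff-pmul-pconst B R zero    = coeff-pmul₀ B [] R
coeff-pmul-pconst B R (suc i) = trans (coeff-pmul-suc B [] R i) (ℚP.+-identityʳ _)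

coeff-pmul-pmono-< : ∀ A k R i → i ℕ.< k → coeff (pmul (pmono A k) R) i ≡ 0ℚ
coeff-pmul-pmono-< A (suc k) R zero    _         = trans (coeff-pmul₀ 0ℚ (pmono A k) R) (ℚP.*-zeroˡ (coeff R 0))
coeff-pmul-pmono-< A (suc k) R (suc i) (s≤s i<k) =
  trans (coeff-pmul-suc 0ℚ (pmono A k) R i)
        (trans (cong₂ _+_ (ℚP.*-zeroˡ (coeff R (suc i))) (coeff-pmul-pmono-< A k R i i<k)) (ℚP.+-identityˡ 0ℚ))

coeff-pmul-pmono-+ : ∀ A k R j → coeff (pmul (pmono A k) R) (k ℕ.+ j) ≡ A * coeff R j
coeff-pmul-pmono-+ A zero    R j = coeff-pmul-pconst A R j
coeff-pmul-pmono-+ A (suc k) R j =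
  trans (coeff-pmul-suc 0ℚ (pmono A k) R (k ℕ.+ j))
        (trans (cong₂ _+_ (ℚP.*-zeroˡ (coeff R (suc (k ℕ.+ j)))) (coeff-pmul-pmono-+ A k R j)) (ℚP.+-identityˡ _))

module BinomialPoly (A B : ℚ) (N-1 : ℕ) where

  N : ℕ
  N = suc N-1

  G : Poly
  G = padd (pconst B) (pmono A N)

  coeff-G₀ : coeff G 0 ≡ B
  coeff-G₀ = trans (coeff-padd (pconst B) (pmono A N) 0) (ℚP.+-identityʳ B)

  coeff-G-N : coeff G N ≡ A
  coeff-G-N = trans (coeff-padd (pconst B) (pmono A N) N)
                    (trans (cong (λ z → 0ℚ + z) (coeff-pmono-≡ A N)) (ℚP.+-identityˡ A))

  coeff-G-middle : ∀ i → 0 ℕ.< i → i ℕ.< N → coeff G i ≡ 0ℚ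
  coeff-G-middle (suc i) _ i<N =
    trans (coeff-padd (pconst B) (pmono A N) (suc i))
          (trans (cong (λ z → 0ℚ + z) (coeff-pmono-≢ A N (suc i) (ℕP.<⇒≢ i<N))) (ℚP.+-identityˡ 0ℚ))

  G-degLE : DegLE G N
  G-degLE (suc i) N<i =
    trans (coeff-padd (pconst B) (pmono A N) (suc i))
          (trans (cong (λ z → 0ℚ + z) (pmono-degLE A N (suc i) N<i)) (ℚP.+-identityˡ 0ℚ))

  coeff-G*-< : ∀ R i → i ℕ.< N → coeff (pmul G R) i ≡ B * coeff R i
  coeff-G*-< R i i<N =
    trans (coeff-pmul-padd (pconst B) (pmono A N) R i)
          (trans (cong₂ _+_ (coeff-pmul-pconst B R i) (coeff-pmul-pmono-< A N R i i<N)) (ℚP.+-identityʳ _))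

  coeff-G*-+ : ∀ R j → coeff (pmul G R) (N ℕ.+ j) ≡ B * coeff R (N ℕ.+ j) + A * coeff R j
  coeff-G*-+ R j = trans (coeff-pmul-padd (pconst B) (pmono A N) R (N ℕ.+ j))
                         (cong₂ _+_ (coeff-pmul-pconst B R (N ℕ.+ j)) (coeff-pmul-pmono-+ A N R j))

  module Power (a : ℚ) where

    -- a Gᵏ, computed as the composite (a xᵏ) ∘ G.
    power : ℕ → Poly
    power k = pcomp (pmono a k) G

    coeff-power-suc : ∀ k i → coeff (power (suc k)) i ≡ coeff (pmul G (power k)) i
    coeff-power-suc k zero    = trans (coeff-pcomp₀ 0ℚ (pmono a k) G) (ℚP.+-identityˡ _)
    coeff-power-suc k (suc i) = coeff-pcomp-suc 0ℚ (pmono a k) G i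

    power-degLE : ∀ k → DegLE (power k) (k ℕ.* N)
    power-degLE k = proj₁ (pcomp-degLE (pmono a k) k G N-1 (pmono-degLE a k) G-degLE)

    coeff-power-jN : ∀ j l → coeff (power (j ℕ.+ l)) (j ℕ.* N) ≡ toℚ (binom j l) * (a * (A ^ℚ j * B ^ℚ l))
    coeff-power-jN zero zero =
      trans (coeff-pcomp₀ a [] G) (trans (cong (λ z → a + z) (pmul-zeroʳ G [] (λ _ → refl) 0)) (normalise a))
      where
      normalise : ∀ a → a + 0ℚ ≡ (1ℚ + 0ℚ) * (a * (1ℚ * 1ℚ))
      normalise = solve-∀ ℚ-ring
    coeff-power-jN zero (suc l) = begin
      coeff (power (suc l)) 0                               ≡⟨ coeff-power-suc l 0 ⟩
      coeff (pmul G (power l)) 0                            ≡⟨ coeff-G*-< (power l) 0 (s≤s z≤n) ⟩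
      B * coeff (power l) 0                                 ≡⟨ cong (B *_) (coeff-power-jN zero l) ⟩
      B * (toℚ 1 * (a * (1ℚ * B ^ℚ l)))                     ≡⟨ regroup (toℚ 1) a B (B ^ℚ l) ⟩
      toℚ 1 * (a * (1ℚ * (B * B ^ℚ l)))                     ∎
      where
      open ≡-Reasoning
      regroup : ∀ x a B Bl → B * (x * (a * (1ℚ * Bl))) ≡ x * (a * (1ℚ * (B * Bl)))
      regroup = solve-∀ ℚ-ring
    coeff-power-jN (suc j) zero = begin
      coeff (power (suc (j ℕ.+ 0))) (N ℕ.+ j ℕ.* N)
        ≡⟨ coeff-power-suc (j ℕ.+ 0) (N ℕ.+ j ℕ.* N) ⟩
      coeff (pmul G (power (j ℕ.+ 0))) (N ℕ.+ j ℕ.* N)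
        ≡⟨ coeff-G*-+ (power (j ℕ.+ 0)) (j ℕ.* N) ⟩
      B * coeff (power (j ℕ.+ 0)) (N ℕ.+ j ℕ.* N) + A * coeff (power (j ℕ.+ 0)) (j ℕ.* N)
        ≡⟨ cong₂ (λ u v → B * u + A * v) (power-degLE (j ℕ.+ 0) (N ℕ.+ j ℕ.* N) above)
                 (trans (coeff-power-jN j 0) (cong (λ k → toℚ k * (a * (A ^ℚ j * 1ℚ))) (binom-zeroʳ j))) ⟩
      B * 0ℚ + A * (toℚ 1 * (a * (A ^ℚ j * 1ℚ)))
        ≡⟨ regroup (toℚ 1) a A B (A ^ℚ j) ⟩
      toℚ 1 * (a * (A * A ^ℚ j * 1ℚ))
        ∎
      where
      open ≡-Reasoning
      binom-zeroʳ : ∀ j → binom j 0 ≡ 1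
      binom-zeroʳ zero    = refl
      binom-zeroʳ (suc j) = refl
      above : (j ℕ.+ 0) ℕ.* N ℕ.< N ℕ.+ j ℕ.* N
      above = subst (ℕ._< N ℕ.+ j ℕ.* N) (cong (ℕ._* N) (sym (ℕP.+-identityʳ j))) (ℕP.m<n+m (j ℕ.* N) (s≤s z≤n))
      regroup : ∀ x a A B Aj → B * 0ℚ + A * (x * (a * (Aj * 1ℚ))) ≡ x * (a * (A * Aj * 1ℚ))
      regroup = solve-∀ ℚ-ring
    coeff-power-jN (suc j) (suc l) = begin
      coeff (power (suc (j ℕ.+ suc l))) (N ℕ.+ j ℕ.* N)
        ≡⟨ coeff-power-suc (j ℕ.+ suc l) (N ℕ.+ j ℕ.* N) ⟩
      coeff (pmul G (power (j ℕ.+ suc l))) (N ℕ.+ j ℕ.* N)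
        ≡⟨ coeff-G*-+ (power (j ℕ.+ suc l)) (j ℕ.* N) ⟩
      B * coeff (power (j ℕ.+ suc l)) (N ℕ.+ j ℕ.* N) + A * coeff (power (j ℕ.+ suc l)) (j ℕ.* N)
        ≡⟨ cong₂ (λ u v → B * u + A * v)
                 (trans (cong (λ k → coeff (power k) (N ℕ.+ j ℕ.* N)) (ℕP.+-suc j l)) (coeff-power-jN (suc j) l))
                 (coeff-power-jN j (suc l)) ⟩
      B * (toℚ y * (a * (A * A ^ℚ j * B ^ℚ l))) + A * (toℚ x * (a * (A ^ℚ j * (B * B ^ℚ l))))
        ≡⟨ pascal (toℚ x) (toℚ y) a A B (A ^ℚ j) (B ^ℚ l) ⟩
      (toℚ x + toℚ y) * (a * (A * A ^ℚ j * (B * B ^ℚ l)))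
        ≡⟨ cong (λ z → z * (a * (A * A ^ℚ j * (B * B ^ℚ l)))) (toℚ-+ x y) ⟨
      toℚ (x ℕ.+ y) * (a * (A * A ^ℚ j * (B * B ^ℚ l)))
        ∎
      where
      open ≡-Reasoning
      x y : ℕ
      x = binom j (suc l)
      y = binom (suc j) l
      pascal : ∀ x y a A B Aj Bl →
        B * (y * (a * (A * Aj * Bl))) + A * (x * (a * (Aj * (B * Bl)))) ≡ (x + y) * (a * (A * Aj * (B * Bl)))
      pascal = solve-∀ ℚ-ring

    coeff-power-off : ∀ k j r → 0 ℕ.< r → r ℕ.< N → coeff (power k) (r ℕ.+ j ℕ.* N) ≡ 0ℚ
    coeff-power-off zero    j       (suc r) _   _   =
      trans (coeff-pcomp-suc a [] G (r ℕ.+ j ℕ.* N)) (pmul-zeroʳ G [] (λ _ → refl) (suc (r ℕ.+ j ℕ.* N)))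
    coeff-power-off (suc k) zero    r       0<r r<N =
      trans (coeff-power-suc k (r ℕ.+ 0))
            (trans (coeff-G*-< (power k) (r ℕ.+ 0) (subst (ℕ._< N) (sym (ℕP.+-identityʳ r)) r<N))
                   (trans (cong (B *_) (coeff-power-off k zero r 0<r r<N)) (ℚP.*-zeroʳ B)))
    coeff-power-off (suc k) (suc j) r       0<r r<N = begin
      coeff (power (suc k)) (r ℕ.+ (N ℕ.+ j ℕ.* N))
        ≡⟨ cong (coeff (power (suc k))) r+N+jN≡N+r+jN ⟩
      coeff (power (suc k)) (N ℕ.+ (r ℕ.+ j ℕ.* N))
        ≡⟨ coeff-power-suc k (N ℕ.+ (r ℕ.+ j ℕ.* N)) ⟩
      coeff (pmul G (power k)) (N ℕ.+ (r ℕ.+ j ℕ.* N))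
        ≡⟨ coeff-G*-+ (power k) (r ℕ.+ j ℕ.* N) ⟩
      B * coeff (power k) (N ℕ.+ (r ℕ.+ j ℕ.* N)) + A * coeff (power k) (r ℕ.+ j ℕ.* N)
        ≡⟨ cong₂ (λ u v → B * u + A * v)
                 (trans (cong (coeff (power k)) (sym r+N+jN≡N+r+jN)) (coeff-power-off k (suc j) r 0<r r<N))
                 (coeff-power-off k j r 0<r r<N) ⟩
      B * 0ℚ + A * 0ℚ
        ≡⟨ vanish A B ⟩
      0ℚ
        ∎
      where
      open ≡-Reasoning
      r+N+jN≡N+r+jN : r ℕ.+ (N ℕ.+ j ℕ.* N) ≡ N ℕ.+ (r ℕ.+ j ℕ.* N)
      r+N+jN≡N+r+jN = swap r N (j ℕ.* N)
        where
        swap : ∀ x y z → x ℕ.+ (y ℕ.+ z) ≡ y ℕ.+ (x ℕ.+ z)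
        swap = ℕ-Solver.solve-∀
      vanish : ∀ A B → B * 0ℚ + A * 0ℚ ≡ 0ℚ
      vanish = solve-∀ ℚ-ring

module ModP {p : ℕ} (p-prime : Prime p) where

  private instance
    p≢0 : ℕ.NonZero p
    p≢0 = prime⇒nonZero p-prime

  1<p : 1 ℕ.< p
  1<p = ℕ.nonTrivial⇒n>1 p {{prime⇒nonTrivial p-prime}}

  1+[p-1]≡p : suc (p ℕ.∸ 1) ≡ p
  1+[p-1]≡p = ℕP.m+[n∸m]≡n (ℕP.<⇒≤ 1<p)

  p∤1 : ¬ p ℕD.∣ 1
  p∤1 p∣1 = ℕP.<⇒≱ 1<p (ℕD.∣⇒≤ p∣1)

  p∤m⇒p∤n⇒p∤m*n : ∀ {m n} → ¬ p ℕD.∣ m → ¬ p ℕD.∣ n → ¬ p ℕD.∣ m ℕ.* n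
  p∤m⇒p∤n⇒p∤m*n {m} {n} p∤m p∤n p∣mn with euclidsLemma m n p-prime p∣mn
  ... | inj₁ p∣m = p∤m p∣m
  ... | inj₂ p∣n = p∤n p∣n

  p∣n⇒p^1∣n : ∀ {n} → p ℕD.∣ n → p ^ 1 ℕD.∣ n
  p∣n⇒p^1∣n {n} = subst (ℕD._∣ n) (sym (ℕP.*-identityʳ p))

  p^[1+k]∣n⇒p∣n : ∀ {n} k → p ^ suc k ℕD.∣ n → p ℕD.∣ n
  p^[1+k]∣n⇒p∣n k = ℕD.∣-trans (ℕD.m∣m*n (p ^ k))

  p^k∣m*n⇒p^k∤m⇒p∣n : ∀ k m n → p ^ k ℕD.∣ m ℕ.* n → ¬ p ^ k ℕD.∣ m → p ℕD.∣ n
  p^k∣m*n⇒p^k∤m⇒p∣n zero    m n _     p^k∤m = ⊥-elim (p^k∤m (ℕD.1∣ m))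
  p^k∣m*n⇒p^k∤m⇒p∣n (suc k) m n p^k∣mn p^k∤m with p ℕD.∣? m
  ... | yes (divides m′ m≡m′p) =
    p^k∣m*n⇒p^k∤m⇒p∣n k m′ n
      (ℕD.*-cancelˡ-∣ p (subst (p ^ suc k ℕD.∣_) (trans (cong (ℕ._* n) m≡m′p) (swap m′ p n)) p^k∣mn))
      (λ p^k∣m′ → p^k∤m (subst (p ^ suc k ℕD.∣_) (trans (ℕP.*-comm p m′) (sym m≡m′p)) (ℕD.*-monoʳ-∣ p p^k∣m′)))
    where
    swap : ∀ a b c → a ℕ.* b ℕ.* c ≡ b ℕ.* (a ℕ.* c)
    swap = ℕ-Solver.solve-∀
  ... | no p∤m with euclidsLemma m n p-prime (ℕD.∣-trans (ℕD.m∣m*n (p ^ k)) p^k∣mn)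
  ...   | inj₁ p∣m = ⊥-elim (p∤m p∣m)
  ...   | inj₂ p∣n = p∣n

  -- By absorption (j+1) C(p^k, j+1) = p^k C(p^k - 1, j), and 0 < j+1 < p^k.
  p∣binom : ∀ k j l → suc j ℕ.+ suc l ≡ p ^ k → p ℕD.∣ binom (suc j) (suc l)
  p∣binom k j l j+l≡p^k = p^k∣m*n⇒p^k∤m⇒p∣n k (suc j) (binom (suc j) (suc l))
    (subst (p ^ k ℕD.∣_) (sym (binom-absorb j (suc l)))
      (subst (λ n → n ℕD.∣ (suc j ℕ.+ suc l) ℕ.* binom j (suc l)) j+l≡p^k (ℕD.m∣m*n _)))
    (λ p^k∣j → ℕP.<⇒≱ j<p^k (ℕD.∣⇒≤ p^k∣j))
    where
    j<p^k : suc j ℕ.< p ^ k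
    j<p^k = subst (suc j ℕ.<_) j+l≡p^k (ℕP.m<m+n (suc j) (s≤s z≤n))

  -- Congruences modulo p

  -- x lies in the localisation ℤ₍ₚ₎.
  record Integral (x : ℚ) : Set where
    constructor integral
    field p∤↧ : ¬ p ℕD.∣ ↧ₙ x

  -- x ≡ 0 (mod p) in ℤ₍ₚ₎; such an x is automatically integral.
  record Divisible (x : ℚ) : Set where
    constructor divisible
    field p∣↥ : p ℕD.∣ ∣ ↥ x ∣

  open Integral public
  open Divisible public

  -- Facts about x read off any unreduced fraction n / d = (↥ x · g) / (↧ x · g).
  module Fraction (x : ℚ) {g n d : ℤ} (↥x*g≡n : ↥ x ℤ.* g ≡ n) (↧x*g≡d : ↧ x ℤ.* g ≡ d) where

    private
      ∣↥x∣*∣g∣≡∣n∣ : ∣ ↥ x ∣ ℕ.* ∣ g ∣ ≡ ∣ n ∣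
      ∣↥x∣*∣g∣≡∣n∣ = trans (sym (ℤP.abs-* (↥ x) g)) (cong ∣_∣ ↥x*g≡n)
      ↧ₙx*∣g∣≡∣d∣ : ↧ₙ x ℕ.* ∣ g ∣ ≡ ∣ d ∣
      ↧ₙx*∣g∣≡∣d∣ = trans (sym (ℤP.abs-* (↧ x) g)) (cong ∣_∣ ↧x*g≡d)

    integral-fraction : ¬ p ℕD.∣ ∣ d ∣ → Integral x
    integral-fraction p∤d = integral λ p∣↧x → p∤d (ℕD.∣-trans p∣↧x (subst (↧ₙ x ℕD.∣_) ↧ₙx*∣g∣≡∣d∣ (ℕD.m∣m*n ∣ g ∣)))

    divisible-fraction : p ℕD.∣ ∣ n ∣ → ¬ p ℕD.∣ ∣ d ∣ → Divisible x
    divisible-fraction p∣n p∤d with euclidsLemma ∣ ↥ x ∣ ∣ g ∣ p-prime (subst (p ℕD.∣_) (sym ∣↥x∣*∣g∣≡∣n∣) p∣n)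
    ... | inj₁ p∣↥x = divisible p∣↥x
    ... | inj₂ p∣g  = ⊥-elim (p∤d (ℕD.∣-trans p∣g (subst (∣ g ∣ ℕD.∣_) ↧ₙx*∣g∣≡∣d∣ (ℕD.n∣m*n (↧ₙ x)))))

    divisible⇒p∣numerator : Divisible x → p ℕD.∣ ∣ n ∣
    divisible⇒p∣numerator (divisible p∣↥x) = subst (p ℕD.∣_) ∣↥x∣*∣g∣≡∣n∣ (ℕD.∣-trans p∣↥x (ℕD.m∣m*n ∣ g ∣))

  private
    p∤↧x*↧y : ∀ x y → Integral x → Integral y → ¬ p ℕD.∣ ∣ ↧ x ℤ.* ↧ y ∣
    p∤↧x*↧y x y (integral p∤↧x) (integral p∤↧y) =
      subst (λ k → ¬ p ℕD.∣ k) (sym (ℤP.abs-* (↧ x) (↧ y))) (p∤m⇒p∤n⇒p∤m*n p∤↧x p∤↧y)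

  integral-0 : Integral 0ℚ
  integral-0 = integral p∤1

  integral-1 : Integral 1ℚ
  integral-1 = integral p∤1

  integral-+ : ∀ {x y} → Integral x → Integral y → Integral (x + y)
  integral-+ {x} {y} ix iy = Fraction.integral-fraction (x + y) (ℚP.↥-+ x y) (ℚP.↧-+ x y) (p∤↧x*↧y x y ix iy)

  integral-* : ∀ {x y} → Integral x → Integral y → Integral (x * y)
  integral-* {x} {y} ix iy = Fraction.integral-fraction (x * y) (ℚP.↥-* x y) (ℚP.↧-* x y) (p∤↧x*↧y x y ix iy)

  integral-neg : ∀ {x} → Integral x → Integral (- x)
  integral-neg {x} (integral p∤↧x) = integral (subst (λ k → ¬ p ℕD.∣ ∣ k ∣) (sym (ℚP.↧-neg x)) p∤↧x)

  integral-^ : ∀ {x} n → Integral x → Integral (x ^ℚ n)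
  integral-^ zero    ix = integral-1
  integral-^ (suc n) ix = integral-* ix (integral-^ n ix)

  divisible⇒integral : ∀ {x} → Divisible x → Integral x
  divisible⇒integral {mkℚ n d coprime} (divisible p∣n) =
    integral λ p∣d → ℕP.<⇒≢ 1<p (sym (Coprime.recompute coprime (p∣n , p∣d)))

  divisible-0 : Divisible 0ℚ
  divisible-0 = divisible (p ℕD.∣0)

  ¬divisible-1 : ¬ Divisible 1ℚ
  ¬divisible-1 (divisible p∣1) = p∤1 p∣1

  divisible-+ : ∀ {x y} → Divisible x → Divisible y → Divisible (x + y)
  divisible-+ {x} {y} dx@(divisible p∣↥x) dy@(divisible p∣↥y) =
    Fraction.divisible-fraction (x + y) (ℚP.↥-+ x y) (ℚP.↧-+ x y)
      (ℤS.∣⇒∣ᵤ {+ p} (ℤS.∣m∣n⇒∣m+n (ℤS.∣m⇒∣m*n (↧ y) (ℤS.∣ᵤ⇒∣ {+ p} {↥ x} p∣↥x))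
                                   (ℤS.∣m⇒∣m*n (↧ x) (ℤS.∣ᵤ⇒∣ {+ p} {↥ y} p∣↥y))))
      (p∤↧x*↧y x y (divisible⇒integral dx) (divisible⇒integral dy))

  divisible-*ˡ : ∀ {x y} → Divisible x → Integral y → Divisible (x * y)
  divisible-*ˡ {x} {y} dx@(divisible p∣↥x) iy =
    Fraction.divisible-fraction (x * y) (ℚP.↥-* x y) (ℚP.↧-* x y)
      (subst (p ℕD.∣_) (sym (ℤP.abs-* (↥ x) (↥ y))) (ℕD.∣-trans p∣↥x (ℕD.m∣m*n ∣ ↥ y ∣)))
      (p∤↧x*↧y x y (divisible⇒integral dx) iy)

  divisible-*ʳ : ∀ {x y} → Integral x → Divisible y → Divisible (x * y)
  divisible-*ʳ {x} {y} ix dy = subst Divisible (ℚP.*-comm y x) (divisible-*ˡ dy ix)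

  divisible-neg : ∀ {x} → Divisible x → Divisible (- x)
  divisible-neg {x} (divisible p∣↥x) =
    divisible (subst (p ℕD.∣_) (sym (trans (cong ∣_∣ (ℚP.↥-neg x)) (ℤP.∣-i∣≡∣i∣ (↥ x)))) p∣↥x)

  ¬divisible-* : ∀ {x y} → ¬ Divisible x → ¬ Divisible y → ¬ Divisible (x * y)
  ¬divisible-* {x} {y} ¬dx ¬dy dxy =
    p∤m⇒p∤n⇒p∤m*n (λ p∣↥x → ¬dx (divisible p∣↥x)) (λ p∣↥y → ¬dy (divisible p∣↥y))
      (subst (p ℕD.∣_) (ℤP.abs-* (↥ x) (↥ y)) (Fraction.divisible⇒p∣numerator (x * y) (ℚP.↥-* x y) (ℚP.↧-* x y) dxy))

  ¬divisible-^ : ∀ {x} n → ¬ Divisible x → ¬ Divisible (x ^ℚ n)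
  ¬divisible-^ zero    ¬dx = ¬divisible-1
  ¬divisible-^ (suc n) ¬dx = ¬divisible-* ¬dx (¬divisible-^ n ¬dx)

  divisible-*-cancelʳ : ∀ {x y} → Divisible (x * y) → ¬ Divisible y → Divisible x
  divisible-*-cancelʳ {x} {y} dxy ¬dy
    with euclidsLemma ∣ ↥ x ∣ ∣ ↥ y ∣ p-prime
           (subst (p ℕD.∣_) (ℤP.abs-* (↥ x) (↥ y)) (Fraction.divisible⇒p∣numerator (x * y) (ℚP.↥-* x y) (ℚP.↧-* x y) dxy))
  ... | inj₁ p∣↥x = divisible p∣↥x
  ... | inj₂ p∣↥y = ⊥-elim (¬dy (divisible p∣↥y))

  divisible? : Decidable Divisible
  divisible? x with p ℕD.∣? ∣ ↥ x ∣
  ... | yes p∣↥x = yes (divisible p∣↥x)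
  ... | no  p∤↥x = no λ dx → p∤↥x (p∣↥ dx)

  infix 4 _≡ₚ_
  record _≡ₚ_ (x y : ℚ) : Set where
    constructor ≡ₚ-intro
    field divisible-diff : Divisible (x - y)

  open _≡ₚ_ public

  ≡ₚ-refl : ∀ {x} → x ≡ₚ x
  ≡ₚ-refl {x} = ≡ₚ-intro (subst Divisible (sym (ℚP.+-inverseʳ x)) divisible-0)

  ≡ₚ-reflexive : ∀ {x y} → x ≡ y → x ≡ₚ y
  ≡ₚ-reflexive refl = ≡ₚ-refl

  ≡ₚ-sym : ∀ {x y} → x ≡ₚ y → y ≡ₚ x
  ≡ₚ-sym {x} {y} (≡ₚ-intro d) = ≡ₚ-intro (subst Divisible (negate x y) (divisible-neg d))
    where
    negate : ∀ x y → - (x - y) ≡ y - x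
    negate = solve-∀ ℚ-ring

  ≡ₚ-trans : ∀ {x y z} → x ≡ₚ y → y ≡ₚ z → x ≡ₚ z
  ≡ₚ-trans {x} {y} {z} (≡ₚ-intro d) (≡ₚ-intro e) = ≡ₚ-intro (subst Divisible (telescope x y z) (divisible-+ d e))
    where
    telescope : ∀ x y z → (x - y) + (y - z) ≡ x - z
    telescope = solve-∀ ℚ-ring

  ≡ₚ-setoid : Setoid _ _
  ≡ₚ-setoid = record
    { Carrier       = ℚ
    ; _≈_           = _≡ₚ_
    ; isEquivalence = record { refl = ≡ₚ-refl ; sym = ≡ₚ-sym ; trans = ≡ₚ-trans }
    }

  module ≡ₚ-Reasoning = SetoidReasoning ≡ₚ-setoid

  ≡ₚ-resp-≡ : ∀ {x x′ y y′} → x ≡ x′ → y ≡ y′ → x′ ≡ₚ y′ → x ≡ₚ y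
  ≡ₚ-resp-≡ refl refl x′≡y′ = x′≡y′

  divisible⇒≡ₚ0 : ∀ {x} → Divisible x → x ≡ₚ 0ℚ
  divisible⇒≡ₚ0 {x} dx = ≡ₚ-intro (subst Divisible (sym (x-0≡x x)) dx)
    where
    x-0≡x : ∀ x → x - 0ℚ ≡ x
    x-0≡x = solve-∀ ℚ-ring

  divisible-resp-≡ₚ : ∀ {x y} → x ≡ₚ y → Divisible y → Divisible x
  divisible-resp-≡ₚ {x} {y} (≡ₚ-intro d) dy = subst Divisible (x-y+y≡x x y) (divisible-+ d dy)
    where
    x-y+y≡x : ∀ x y → (x - y) + y ≡ x
    x-y+y≡x = solve-∀ ℚ-ring

  ≡ₚ0⇒divisible : ∀ {x} → x ≡ₚ 0ℚ → Divisible x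
  ≡ₚ0⇒divisible x≡0 = divisible-resp-≡ₚ x≡0 divisible-0

  integral-resp-≡ₚ : ∀ {x y} → x ≡ₚ y → Integral y → Integral x
  integral-resp-≡ₚ {x} {y} (≡ₚ-intro d) iy = subst Integral (x-y+y≡x x y) (integral-+ (divisible⇒integral d) iy)
    where
    x-y+y≡x : ∀ x y → (x - y) + y ≡ x
    x-y+y≡x = solve-∀ ℚ-ring

  +-congₚ : ∀ {x x′ y y′} → x ≡ₚ x′ → y ≡ₚ y′ → x + y ≡ₚ x′ + y′
  +-congₚ {x} {x′} {y} {y′} (≡ₚ-intro d) (≡ₚ-intro e) = ≡ₚ-intro (subst Divisible (regroup x x′ y y′) (divisible-+ d e))
    where
    regroup : ∀ x x′ y y′ → (x - x′) + (y - y′) ≡ (x + y) - (x′ + y′)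
    regroup = solve-∀ ℚ-ring

  *-congₚ : ∀ {x x′ y y′} → Integral x′ → Integral y → x ≡ₚ x′ → y ≡ₚ y′ → x * y ≡ₚ x′ * y′
  *-congₚ {x} {x′} {y} {y′} ix′ iy (≡ₚ-intro d) (≡ₚ-intro e) =
    ≡ₚ-intro (subst Divisible (regroup x x′ y y′) (divisible-+ (divisible-*ˡ d iy) (divisible-*ʳ ix′ e)))
    where
    regroup : ∀ x x′ y y′ → (x - x′) * y + x′ * (y - y′) ≡ (x * y) - (x′ * y′)
    regroup = solve-∀ ℚ-ring

  ^-congₚ : ∀ {x x′} n → Integral x′ → x ≡ₚ x′ → x ^ℚ n ≡ₚ x′ ^ℚ n
  ^-congₚ zero    ix′ x≡x′ = ≡ₚ-refl
  ^-congₚ (suc n) ix′ x≡x′ = *-congₚ ix′ (integral-^ n (integral-resp-≡ₚ x≡x′ ix′)) x≡x′ (^-congₚ n ix′ x≡x′)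

  exactPow-exists : ∀ n → n ≢ 0 → ∃[ e ] ExactPow p e n
  exactPow-exists = <-rec _ step
    where
    step : ∀ n → (∀ {m} → m ℕ.< n → m ≢ 0 → ∃[ e ] ExactPow p e m) → n ≢ 0 → ∃[ e ] ExactPow p e n
    step n rec n≢0 with p ℕD.∣? n
    ... | no  p∤n = 0 , ℕD.1∣ n , λ p^1∣n → p∤n (subst (ℕD._∣ n) (ℕP.*-identityʳ p) p^1∣n)
    ... | yes (divides q n≡qp) with rec q<n q≢0
      where
      q≢0 : q ≢ 0
      q≢0 q≡0 = n≢0 (trans n≡qp (cong (ℕ._* p) q≡0))
      q<n : q ℕ.< n
      q<n = subst (q ℕ.<_) (sym n≡qp) (ℕP.m<m*n q p {{ℕ.≢-nonZero q≢0}} 1<p)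
    ...   | e , p^e∣q , p^[1+e]∤q =
      suc e
        , subst (p ^ suc e ℕD.∣_) (trans (ℕP.*-comm p q) (sym n≡qp)) (ℕD.*-monoʳ-∣ p p^e∣q)
        , λ p^[2+e]∣n → p^[1+e]∤q (ℕD.*-cancelˡ-∣ p (subst (p ^ suc (suc e) ℕD.∣_) (trans n≡qp (ℕP.*-comm q p)) p^[2+e]∣n))

  valGE1⇒divisible : ∀ {c} → ValGE p (+ 1) c → Divisible c
  valGE1⇒divisible (inj₁ refl) = divisible-0
  valGE1⇒divisible (inj₂ (_ , (zero  , zero  , _ , _ , refl) , ℤ.+≤+ ()))
  valGE1⇒divisible (inj₂ (_ , (zero  , suc _ , _ , _ , refl) , ()))
  valGE1⇒divisible (inj₂ (_ , (suc k , _     , (p^[1+k]∣↥c , _) , _ , refl) , _)) =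
    divisible (p^[1+k]∣n⇒p∣n k p^[1+k]∣↥c)

  divisible⇒valGE1 : ∀ {c} → Divisible c → ValGE p (+ 1) c
  divisible⇒valGE1 {c} dc@(divisible p∣↥c) with ∣ ↥ c ∣ ℕ.≟ 0
  ... | yes ∣↥c∣≡0 = inj₁ (ℚP.↥p≡0⇒p≡0 c (ℤP.∣i∣≡0⇒i≡0 ∣↥c∣≡0))
  ... | no  ∣↥c∣≢0 with exactPow-exists ∣ ↥ c ∣ ∣↥c∣≢0
  ...   | zero  , _ , p∤↥c = ⊥-elim (p∤↥c (p∣n⇒p^1∣n p∣↥c))
  ...   | suc k , exact =
    inj₂ (_ , (suc k , 0 , exact , (ℕD.1∣ _ , p^1∤↧c) , refl) , ℤ.+≤+ (s≤s z≤n))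
    where
    p^1∤↧c : ¬ p ^ 1 ℕD.∣ ↧ₙ c
    p^1∤↧c p^1∣↧c = p∤↧ (divisible⇒integral dc) (subst (ℕD._∣ ↧ₙ c) (ℕP.*-identityʳ p) p^1∣↧c)

  valGE0⇒integral : ∀ {c} → ValGE p (+ 0) c → Integral c
  valGE0⇒integral (inj₁ refl) = integral-0
  valGE0⇒integral (inj₂ (_ , (_     , zero  , _ , (_ , p∤↧c) , refl) , _)) = integral λ p∣↧c → p∤↧c (p∣n⇒p^1∣n p∣↧c)
  valGE0⇒integral (inj₂ (_ , (zero  , suc _ , _ , _ , refl) , ()))
  valGE0⇒integral (inj₂ (_ , (suc j , suc _ , (p^[1+j]∣↥c , _) , _ , refl) , _)) =
    divisible⇒integral (divisible (p^[1+k]∣n⇒p∣n j p^[1+j]∣↥c))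

  val0⇒integral : ∀ {c} → Val p c (+ 0) → Integral c
  val0⇒integral v = valGE0⇒integral (inj₂ (_ , v , ℤP.≤-refl))

  val0⇒¬divisible : ∀ {c} → Val p c (+ 0) → ¬ Divisible c
  val0⇒¬divisible (zero  , zero  , (_ , p∤↥c) , _ , _) (divisible p∣↥c) = p∤↥c (p∣n⇒p^1∣n p∣↥c)
  val0⇒¬divisible (zero  , suc _ , _ , _ , ())
  val0⇒¬divisible (suc _ , zero  , _ , _ , ())
  val0⇒¬divisible {c} (suc j , suc k , (p^[1+j]∣↥c , _) , (p^[1+k]∣↧c , _) , _) _ =
    p∤↧ (divisible⇒integral {c} (divisible (p^[1+k]∣n⇒p∣n j p^[1+j]∣↥c))) (p^[1+k]∣n⇒p∣n k p^[1+k]∣↧c)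

  integral∧¬divisible⇒val0 : ∀ {c} → Integral c → ¬ Divisible c → Val p c (+ 0)
  integral∧¬divisible⇒val0 {c} (integral p∤↧c) ¬dc =
    0 , 0 , (ℕD.1∣ _ , λ p^1∣↥c → ¬dc (divisible (subst (ℕD._∣ ∣ ↥ c ∣) (ℕP.*-identityʳ p) p^1∣↥c)))
          , (ℕD.1∣ _ , λ p^1∣↧c → p∤↧c (subst (ℕD._∣ ↧ₙ c) (ℕP.*-identityʳ p) p^1∣↧c))
          , refl

  congModP⇒≡ₚ : ∀ {x y} → CongModP p x y → x ≡ₚ y
  congModP⇒≡ₚ v = ≡ₚ-intro (valGE1⇒divisible v)

  ≡ₚ⇒congModP : ∀ {x y} → x ≡ₚ y → CongModP p x y
  ≡ₚ⇒congModP (≡ₚ-intro d) = divisible⇒valGE1 d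

  -- Fermat's little theorem

  integral-toℚ : ∀ n → Integral (toℚ n)
  integral-toℚ n = integral (subst (λ d → ¬ p ℕD.∣ d) (sym (proj₂ (toℚ-fraction n))) p∤1)

  divisible-toℚ : ∀ {n} → p ℕD.∣ n → Divisible (toℚ n)
  divisible-toℚ {n} p∣n = divisible (subst (p ℕD.∣_) (sym (cong ∣_∣ (proj₁ (toℚ-fraction n)))) p∣n)

  divisible-toℚ⁻¹ : ∀ {n} → Divisible (toℚ n) → p ℕD.∣ n
  divisible-toℚ⁻¹ {n} (divisible p∣↥n) = subst (p ℕD.∣_) (cong ∣_∣ (proj₁ (toℚ-fraction n))) p∣↥n

  inverse-mod-p : ∀ {s} → ¬ p ℕD.∣ s → ∃[ u ] (+ p) ℤS.∣ (u ℤ.* + s ℤ.- + 1)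
  inverse-mod-p {s} p∤s with Coprime.coprime-Bézout s-coprime-p
    where
    s-coprime-p : Coprime.Coprime s p
    s-coprime-p {d} (d∣s , d∣p) with prime⇒irreducible p-prime d∣p
    ... | inj₁ d≡1 = d≡1
    ... | inj₂ d≡p = ⊥-elim (p∤s (subst (ℕD._∣ s) d≡p d∣s))
  ... | GCD.Bézout.+- x y 1+yp≡xs = + x , ℤS.divides (+ y) (begin
    + x ℤ.* + s ℤ.- + 1             ≡⟨ cong (ℤ._- + 1) (lift 1+yp≡xs) ⟨
    (+ 1 ℤ.+ + y ℤ.* + p) ℤ.- + 1   ≡⟨ cancel (+ y ℤ.* + p) ⟩
    + y ℤ.* + p                     ∎)
    where
    open ≡-Reasoning
    cancel : ∀ z → (+ 1 ℤ.+ z) ℤ.- + 1 ≡ z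
    cancel = ℤ-Solver.solve-∀
    lift : 1 ℕ.+ y ℕ.* p ≡ x ℕ.* s → + 1 ℤ.+ + y ℤ.* + p ≡ + x ℤ.* + s
    lift eq = trans (cong (λ k → + 1 ℤ.+ k) (sym (ℤP.pos-* y p)))
                    (trans (sym (ℤP.pos-+ 1 (y ℕ.* p))) (trans (cong +_ eq) (ℤP.pos-* x s)))
  ... | GCD.Bézout.-+ x y 1+xs≡yp = ℤ.- + x , ℤS.divides (ℤ.- + y) (begin
    (ℤ.- + x) ℤ.* + s ℤ.- + 1       ≡⟨ negate (+ x) (+ s) ⟩
    ℤ.- (+ 1 ℤ.+ + x ℤ.* + s)       ≡⟨ cong ℤ.-_ (lift 1+xs≡yp) ⟩
    ℤ.- (+ y ℤ.* + p)               ≡⟨ ℤP.neg-distribˡ-* (+ y) (+ p) ⟩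
    (ℤ.- + y) ℤ.* + p               ∎)
    where
    open ≡-Reasoning
    negate : ∀ x s → (ℤ.- x) ℤ.* s ℤ.- + 1 ≡ ℤ.- (+ 1 ℤ.+ x ℤ.* s)
    negate = ℤ-Solver.solve-∀
    lift : 1 ℕ.+ x ℕ.* s ≡ y ℕ.* p → + 1 ℤ.+ + x ℤ.* + s ≡ + y ℤ.* + p
    lift eq = trans (cong (λ k → + 1 ℤ.+ k) (sym (ℤP.pos-* x s)))
                    (trans (sym (ℤP.pos-+ 1 (x ℕ.* s))) (trans (cong +_ eq) (ℤP.pos-* y p)))

  -- With u ↧x ≡ 1 (mod p), the natural number (↥x u mod p) represents x.
  ≡ₚ-toℚ : ∀ {x} → Integral x → ∃[ n ] x ≡ₚ toℚ n
  ≡ₚ-toℚ {x} (integral p∤s) = n , ≡ₚ-intro (Fraction.divisible-fraction (x - toℚ n)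
                                   (ℚP.↥-+ x (- toℚ n)) (ℚP.↧-+ x (- toℚ n)) p∣numerator p∤denominator)
    where
    r u q : ℤ
    r = ↥ x
    u = proj₁ (inverse-mod-p p∤s)
    q = (r ℤ.* u) ℤDM./ℕ p
    s n : ℕ
    s = ↧ₙ x
    n = (r ℤ.* u) ℤDM.%ℕ p
    ↥-toℚn : ↥ (- toℚ n) ≡ ℤ.- + n
    ↥-toℚn = trans (ℚP.↥-neg (toℚ n)) (cong ℤ.-_ (proj₁ (toℚ-fraction n)))
    ↧-toℚn : ↧ (- toℚ n) ≡ + 1
    ↧-toℚn = trans (ℚP.↧-neg (toℚ n)) (cong +_ (proj₂ (toℚ-fraction n)))
    n≡ru-qp : + n ≡ r ℤ.* u ℤ.- q ℤ.* + p
    n≡ru-qp = trans (sym (cancel (+ n) (q ℤ.* + p))) (cong (ℤ._- q ℤ.* + p) (sym (ℤDM.a≡a%ℕn+[a/ℕn]*n (r ℤ.* u) p)))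
      where
      cancel : ∀ a b → (a ℤ.+ b) ℤ.- b ≡ a
      cancel = ℤ-Solver.solve-∀
    numerator : r ℤ.* ↧ (- toℚ n) ℤ.+ ↥ (- toℚ n) ℤ.* ↧ x ≡ q ℤ.* + s ℤ.* + p ℤ.+ ℤ.- r ℤ.* (u ℤ.* + s ℤ.- + 1)
    numerator = begin
      r ℤ.* ↧ (- toℚ n) ℤ.+ ↥ (- toℚ n) ℤ.* ↧ x           ≡⟨ cong₂ (λ d k → r ℤ.* d ℤ.+ k ℤ.* + s) ↧-toℚn ↥-toℚn ⟩
      r ℤ.* + 1 ℤ.+ ℤ.- + n ℤ.* + s                       ≡⟨ cong (λ k → r ℤ.* + 1 ℤ.+ ℤ.- k ℤ.* + s) n≡ru-qp ⟩
      r ℤ.* + 1 ℤ.+ ℤ.- (r ℤ.* u ℤ.- q ℤ.* + p) ℤ.* + s   ≡⟨ regroup r u q (+ s) (+ p) ⟩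
      q ℤ.* + s ℤ.* + p ℤ.+ ℤ.- r ℤ.* (u ℤ.* + s ℤ.- + 1) ∎
      where
      open ≡-Reasoning
      regroup : ∀ r u q s p → r ℤ.* + 1 ℤ.+ ℤ.- (r ℤ.* u ℤ.- q ℤ.* p) ℤ.* s ≡ q ℤ.* s ℤ.* p ℤ.+ ℤ.- r ℤ.* (u ℤ.* s ℤ.- + 1)
      regroup = ℤ-Solver.solve-∀
    p∣numerator : p ℕD.∣ ∣ r ℤ.* ↧ (- toℚ n) ℤ.+ ↥ (- toℚ n) ℤ.* ↧ x ∣
    p∣numerator = ℤS.∣⇒∣ᵤ (subst ((+ p) ℤS.∣_) (sym numerator)
      (ℤS.∣m∣n⇒∣m+n (ℤS.∣n⇒∣m*n (q ℤ.* + s) ℤS.∣-refl) (ℤS.∣n⇒∣m*n (ℤ.- r) (proj₂ (inverse-mod-p p∤s)))))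
    p∤denominator : ¬ p ℕD.∣ ∣ ↧ x ℤ.* ↧ (- toℚ n) ∣
    p∤denominator p∣d = p∤s (subst (p ℕD.∣_) (trans (cong (λ k → ∣ ↧ x ℤ.* k ∣) ↧-toℚn) (ℕP.*-identityʳ s)) p∣d)

  private
    ℚ-commutativeSemiring : CommutativeSemiring _ _
    ℚ-commutativeSemiring = CommutativeRing.commutativeSemiring ℚP.+-*-commutativeRing
    module ℚ-Semiring = CommutativeSemiring ℚ-commutativeSemiring
    module BinomialTheorem = CommutativeSemiringBinomial ℚ-commutativeSemiring
    module Exp = SemiringExp ℚ-Semiring.semiring
    module Mult = RawMonoidDefs ℚ-Semiring.+-rawMonoid
    module Sum = MonoidSum ℚ-Semiring.+-monoid

    ^≡^ℚ : ∀ x n → x Exp.^ n ≡ x ^ℚ n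
    ^≡^ℚ x zero    = refl
    ^≡^ℚ x (suc n) = cong (x *_) (^≡^ℚ x n)

    ×≡toℚ* : ∀ n x → n Mult.× x ≡ toℚ n * x
    ×≡toℚ* zero    x = sym (ℚP.*-zeroˡ x)
    ×≡toℚ* (suc n) x = trans (cong (λ z → x + z) (×≡toℚ* n x)) (distrib x (toℚ n))
      where
      distrib : ∀ x n → x + n * x ≡ (1ℚ + n) * x
      distrib = solve-∀ ℚ-ring

    sum-≡ₚ-last : ∀ n (v : Fin (suc n) → ℚ) → (∀ i → Divisible (v (inject₁ i))) → Sum.sum v ≡ₚ v (fromℕ n)
    sum-≡ₚ-last zero    v _ = ≡ₚ-reflexive (ℚP.+-identityʳ (v Fin.zero))
    sum-≡ₚ-last (suc n) v d = ≡ₚ-trans (+-congₚ (divisible⇒≡ₚ0 (d Fin.zero)) (sum-≡ₚ-last n (v ∘ Fin.suc) (d ∘ Fin.suc)))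
                                      (≡ₚ-reflexive (ℚP.+-identityˡ _))

    frobenius′ : ∀ {x y} n → suc n ≡ p → Integral x → Integral y → (x + y) ^ℚ suc n ≡ₚ x ^ℚ suc n + y ^ℚ suc n
    frobenius′ {x} {y} n 1+n≡p ix iy = begin
      (x + y) ^ℚ suc n                           ≡⟨ ^≡^ℚ (x + y) (suc n) ⟨
      (x + y) Exp.^ suc n                        ≡⟨ BinomialTheorem.theorem (suc n) x y ⟩
      term Fin.zero + Sum.sum (term ∘ Fin.suc)  ≈⟨ +-congₚ (≡ₚ-reflexive first)
                                                             (≡ₚ-trans (sum-≡ₚ-last n (term ∘ Fin.suc) middle) (≡ₚ-reflexive last)) ⟩
      y ^ℚ suc n + x ^ℚ suc n                    ≡⟨ ℚP.+-comm (y ^ℚ suc n) (x ^ℚ suc n) ⟩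
      x ^ℚ suc n + y ^ℚ suc n                    ∎
      where
      open ≡ₚ-Reasoning
      term : Fin (suc (suc n)) → ℚ
      term = BinomialTheorem.binomialTerm x y (suc n)
      first : term Fin.zero ≡ y ^ℚ suc n
      first = trans (ℚP.+-identityʳ _) (trans (ℚP.*-identityˡ _) (^≡^ℚ y (suc n)))
      last : term (Fin.suc (fromℕ n)) ≡ x ^ℚ suc n
      last rewrite FinP.toℕ-fromℕ n | nCn≡1 (suc n) | ℕP.n∸n≡0 n =
        trans (ℚP.+-identityʳ _) (trans (ℚP.*-identityʳ _) (^≡^ℚ x (suc n)))
      middle : ∀ i → Divisible (term (Fin.suc (inject₁ i)))
      middle i = subst Divisible (sym (×≡toℚ* (suc n C suc j) _)) (divisible-*ˡ (divisible-toℚ p∣C) integral-monomial)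
        where
        j : ℕ
        j = Fin.toℕ (inject₁ i)
        j<n : j ℕ.< n
        j<n = subst (ℕ._< n) (sym (FinP.toℕ-inject₁ i)) (FinP.toℕ<n i)
        l : ℕ
        l = n ℕ.∸ suc j
        j+l≡n : suc j ℕ.+ suc l ≡ suc n
        j+l≡n = cong suc (trans (ℕP.+-suc j l) (ℕP.m+[n∸m]≡n j<n))
        p∣C : p ℕD.∣ suc n C suc j
        p∣C = subst (p ℕD.∣_) (trans (binom≡C (suc j) (suc l)) (cong (_C suc j) j+l≡n))
                    (p∣binom 1 j l (trans j+l≡n (trans 1+n≡p (sym (ℕP.*-identityʳ p)))))
        integral-monomial : Integral (x Exp.^ suc j * y Exp.^ (suc n ℕ.∸ suc j))
        integral-monomial = integral-* (subst Integral (sym (^≡^ℚ x (suc j))) (integral-^ (suc j) ix))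
                                       (subst Integral (sym (^≡^ℚ y (suc n ℕ.∸ suc j))) (integral-^ (suc n ℕ.∸ suc j) iy))

  frobenius : ∀ {x y} → Integral x → Integral y → (x + y) ^ℚ p ≡ₚ x ^ℚ p + y ^ℚ p
  frobenius {x} {y} = subst (λ k → Integral x → Integral y → (x + y) ^ℚ k ≡ₚ x ^ℚ k + y ^ℚ k) 1+[p-1]≡p
                            (frobenius′ (p ℕ.∸ 1) 1+[p-1]≡p)

  fermat-toℚ : ∀ n → toℚ n ^ℚ p ≡ₚ toℚ n
  fermat-toℚ zero    = ≡ₚ-reflexive (subst (λ k → 0ℚ ^ℚ k ≡ 0ℚ) 1+[p-1]≡p (ℚP.*-zeroˡ (0ℚ ^ℚ (p ℕ.∸ 1))))
  fermat-toℚ (suc n) = ≡ₚ-trans (frobenius integral-1 (integral-toℚ n)) (+-congₚ (≡ₚ-reflexive (1^ℚn≡1 p)) (fermat-toℚ n))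

  fermat : ∀ {x} → Integral x → x ^ℚ p ≡ₚ x
  fermat {x} ix = ≡ₚ-trans (^-congₚ p (integral-toℚ n) x≡n) (≡ₚ-trans (fermat-toℚ n) (≡ₚ-sym x≡n))
    where
    n : ℕ
    n = proj₁ (≡ₚ-toℚ ix)
    x≡n : x ≡ₚ toℚ n
    x≡n = proj₂ (≡ₚ-toℚ ix)

  fermat-p^k : ∀ k {x} → Integral x → x ^ℚ (p ^ k) ≡ₚ x
  fermat-p^k zero    {x} ix = ≡ₚ-reflexive (ℚP.*-identityʳ x)
  fermat-p^k (suc k) {x} ix = begin
    x ^ℚ (p ℕ.* p ^ k)        ≡⟨ ^ℚ-*-assoc x p (p ^ k) ⟨
    (x ^ℚ p) ^ℚ (p ^ k)       ≈⟨ fermat-p^k k (integral-^ p ix) ⟩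
    x ^ℚ p                    ≈⟨ fermat ix ⟩
    x                         ∎
    where open ≡ₚ-Reasoning

  fermat-unit : ∀ {a} → Integral a → ¬ Divisible a → a ^ℚ (p ℕ.∸ 1) ≡ₚ 1ℚ
  fermat-unit {a} ia ¬da = ≡ₚ-intro (divisible-*-cancelʳ (subst Divisible (factor a (a ^ℚ (p ℕ.∸ 1))) (divisible-diff a^p≡a)) ¬da)
    where
    a^p≡a : a * a ^ℚ (p ℕ.∸ 1) ≡ₚ a
    a^p≡a = subst (λ k → a ^ℚ k ≡ₚ a) (sym 1+[p-1]≡p) (fermat ia)
    factor : ∀ a b → a * b - a ≡ (b - 1ℚ) * a
    factor = solve-∀ ℚ-ring

  integral-geom : ∀ {a} n → Integral a → Integral (geom a n)
  integral-geom zero    ia = integral-0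
  integral-geom (suc n) ia = integral-+ integral-1 (integral-* ia (integral-geom n ia))

  geom-≡ₚ-toℚ : ∀ {a} → a ≡ₚ 1ℚ → ∀ n → geom a n ≡ₚ toℚ n
  geom-≡ₚ-toℚ a≡1 zero    = ≡ₚ-refl
  geom-≡ₚ-toℚ {a} a≡1 (suc n) =
    +-congₚ (≡ₚ-refl {1ℚ}) (≡ₚ-trans (*-congₚ integral-1 integral-geom′ a≡1 (geom-≡ₚ-toℚ a≡1 n))
                                      (≡ₚ-reflexive (ℚP.*-identityˡ (toℚ n))))
    where
    integral-geom′ : Integral (geom a n)
    integral-geom′ = integral-geom n (integral-resp-≡ₚ a≡1 integral-1)

  divisible-geom⇒^≡ₚ1 : ∀ {a} n → Integral a → Divisible (geom a n) → a ^ℚ n ≡ₚ 1ℚ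
  divisible-geom⇒^≡ₚ1 {a} n ia d =
    ≡ₚ-intro (subst Divisible ([x-1]*geom≡x^n-1 a n) (divisible-*ʳ (integral-+ ia (integral-neg integral-1)) d))

  ^≡ₚ1⇒divisible-geom : ∀ {a} n → ¬ a ≡ₚ 1ℚ → a ^ℚ n ≡ₚ 1ℚ → Divisible (geom a n)
  ^≡ₚ1⇒divisible-geom {a} n a≢1 (≡ₚ-intro d) =
    divisible-*-cancelʳ (subst Divisible (trans (sym ([x-1]*geom≡x^n-1 a n)) (ℚP.*-comm (a - 1ℚ) (geom a n))) d)
                        (λ d′ → a≢1 (≡ₚ-intro d′))

  -- Polynomials modulo p

  IntegralPoly : Poly → Set
  IntegralPoly P = ∀ i → Integral (coeff P i)

  DivisiblePoly : Poly → Set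
  DivisiblePoly P = ∀ i → Divisible (coeff P i)

  infix 4 _≡ₚ[x]_
  _≡ₚ[x]_ : Poly → Poly → Set
  P ≡ₚ[x] Q = ∀ i → coeff P i ≡ₚ coeff Q i

  integralPoly-padd : ∀ P Q → IntegralPoly P → IntegralPoly Q → IntegralPoly (padd P Q)
  integralPoly-padd P Q iP iQ i = subst Integral (sym (coeff-padd P Q i)) (integral-+ (iP i) (iQ i))

  integralPoly-pmul : ∀ P R → IntegralPoly P → IntegralPoly R → IntegralPoly (pmul P R)
  integralPoly-pmul []      R iP iR i       = integral-0
  integralPoly-pmul (a ∷ P) R iP iR zero    = subst Integral (sym (coeff-pmul₀ a P R)) (integral-* (iP 0) (iR 0))
  integralPoly-pmul (a ∷ P) R iP iR (suc i) =
    subst Integral (sym (coeff-pmul-suc a P R i))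
          (integral-+ (integral-* (iP 0) (iR (suc i))) (integralPoly-pmul P R (iP ∘ suc) iR i))

  integralPoly-pconst : ∀ {c} → Integral c → IntegralPoly (pconst c)
  integralPoly-pconst ic zero    = ic
  integralPoly-pconst ic (suc i) = integral-0

  integralPoly-pmono : ∀ {c} k → Integral c → IntegralPoly (pmono c k)
  integralPoly-pmono {c} k ic i with i ℕ.≟ k
  ... | yes refl = subst Integral (sym (coeff-pmono-≡ c k)) ic
  ... | no  i≢k  = subst Integral (sym (coeff-pmono-≢ c k i i≢k)) integral-0

  integralPoly-pcomp : ∀ F g → IntegralPoly F → IntegralPoly g → IntegralPoly (pcomp F g)
  integralPoly-pcomp []      g iF ig i = integral-0
  integralPoly-pcomp (c ∷ F) g iF ig =
    integralPoly-padd (pconst c) (pmul g (pcomp F g)) (integralPoly-pconst (iF 0))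
                      (integralPoly-pmul g (pcomp F g) ig (integralPoly-pcomp F g (iF ∘ suc) ig))

  divisiblePoly⇒≡ₚ[x]0 : ∀ P → DivisiblePoly P → P ≡ₚ[x] []
  divisiblePoly⇒≡ₚ[x]0 P dP i = divisible⇒≡ₚ0 (dP i)

  ≡ₚ[x]0⇒divisiblePoly : ∀ P → P ≡ₚ[x] [] → DivisiblePoly P
  ≡ₚ[x]0⇒divisiblePoly P P≡0 i = ≡ₚ0⇒divisible (P≡0 i)

  padd-congₚ : ∀ P P′ Q Q′ → P ≡ₚ[x] P′ → Q ≡ₚ[x] Q′ → padd P Q ≡ₚ[x] padd P′ Q′
  padd-congₚ P P′ Q Q′ P≡P′ Q≡Q′ i = ≡ₚ-resp-≡ (coeff-padd P Q i) (coeff-padd P′ Q′ i) (+-congₚ (P≡P′ i) (Q≡Q′ i))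

  divisiblePoly-pmulˡ : ∀ P R → DivisiblePoly P → IntegralPoly R → DivisiblePoly (pmul P R)
  divisiblePoly-pmulˡ []      R dP iR i       = divisible-0
  divisiblePoly-pmulˡ (a ∷ P) R dP iR zero    = subst Divisible (sym (coeff-pmul₀ a P R)) (divisible-*ˡ (dP 0) (iR 0))
  divisiblePoly-pmulˡ (a ∷ P) R dP iR (suc i) =
    subst Divisible (sym (coeff-pmul-suc a P R i))
          (divisible-+ (divisible-*ˡ (dP 0) (iR (suc i))) (divisiblePoly-pmulˡ P R (dP ∘ suc) iR i))

  divisiblePoly-pmulʳ : ∀ P R → IntegralPoly P → DivisiblePoly R → DivisiblePoly (pmul P R)
  divisiblePoly-pmulʳ []      R iP dR i       = divisible-0
  divisiblePoly-pmulʳ (a ∷ P) R iP dR zero    = subst Divisible (sym (coeff-pmul₀ a P R)) (divisible-*ʳ (iP 0) (dR 0))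
  divisiblePoly-pmulʳ (a ∷ P) R iP dR (suc i) =
    subst Divisible (sym (coeff-pmul-suc a P R i))
          (divisible-+ (divisible-*ʳ (iP 0) (dR (suc i))) (divisiblePoly-pmulʳ P R (iP ∘ suc) dR i))

  pmul-congˡₚ : ∀ P P′ R → P ≡ₚ[x] P′ → IntegralPoly P′ → IntegralPoly R → pmul P R ≡ₚ[x] pmul P′ R
  pmul-congˡₚ []      []        R P≡P′ iP′ iR i = ≡ₚ-refl
  pmul-congˡₚ (a ∷ P) []        R P≡P′ iP′ iR   =
    divisiblePoly⇒≡ₚ[x]0 (pmul (a ∷ P) R) (divisiblePoly-pmulˡ (a ∷ P) R (≡ₚ[x]0⇒divisiblePoly (a ∷ P) P≡P′) iR)
  pmul-congˡₚ []      (a′ ∷ P′) R P≡P′ iP′ iR i =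
    ≡ₚ-sym (divisiblePoly⇒≡ₚ[x]0 (pmul (a′ ∷ P′) R)
             (divisiblePoly-pmulˡ (a′ ∷ P′) R (≡ₚ[x]0⇒divisiblePoly (a′ ∷ P′) (≡ₚ-sym ∘ P≡P′)) iR) i)
  pmul-congˡₚ (a ∷ P) (a′ ∷ P′) R P≡P′ iP′ iR zero    =
    ≡ₚ-resp-≡ (coeff-pmul₀ a P R) (coeff-pmul₀ a′ P′ R) (*-congₚ (iP′ 0) (iR 0) (P≡P′ 0) ≡ₚ-refl)
  pmul-congˡₚ (a ∷ P) (a′ ∷ P′) R P≡P′ iP′ iR (suc i) =
    ≡ₚ-resp-≡ (coeff-pmul-suc a P R i) (coeff-pmul-suc a′ P′ R i)
      (+-congₚ (*-congₚ (iP′ 0) (iR (suc i)) (P≡P′ 0) ≡ₚ-refl) (pmul-congˡₚ P P′ R (P≡P′ ∘ suc) (iP′ ∘ suc) iR i))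

  pmul-congʳₚ : ∀ P R R′ → IntegralPoly P → R ≡ₚ[x] R′ → IntegralPoly R′ → pmul P R ≡ₚ[x] pmul P R′
  pmul-congʳₚ []      R R′ iP R≡R′ iR′ i       = ≡ₚ-refl
  pmul-congʳₚ (a ∷ P) R R′ iP R≡R′ iR′ zero    =
    ≡ₚ-resp-≡ (coeff-pmul₀ a P R) (coeff-pmul₀ a P R′) (*-congₚ (iP 0) (integral-resp-≡ₚ (R≡R′ 0) (iR′ 0)) ≡ₚ-refl (R≡R′ 0))
  pmul-congʳₚ (a ∷ P) R R′ iP R≡R′ iR′ (suc i) =
    ≡ₚ-resp-≡ (coeff-pmul-suc a P R i) (coeff-pmul-suc a P R′ i)
      (+-congₚ (*-congₚ (iP 0) (integral-resp-≡ₚ (R≡R′ (suc i)) (iR′ (suc i))) ≡ₚ-refl (R≡R′ (suc i)))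
               (pmul-congʳₚ P R R′ (iP ∘ suc) R≡R′ iR′ i))

  divisiblePoly-pcomp : ∀ F g → DivisiblePoly F → IntegralPoly g → DivisiblePoly (pcomp F g)
  divisiblePoly-pcomp []      g dF ig i = divisible-0
  divisiblePoly-pcomp (c ∷ F) g dF ig i =
    subst Divisible (sym (coeff-padd (pconst c) (pmul g (pcomp F g)) i))
          (divisible-+ (divisible-const i) (divisiblePoly-pmulʳ g (pcomp F g) ig (divisiblePoly-pcomp F g (dF ∘ suc) ig) i))
    where
    divisible-const : DivisiblePoly (pconst c)
    divisible-const zero    = dF 0
    divisible-const (suc i) = divisible-0

  pcomp-congˡₚ : ∀ F F′ g → F ≡ₚ[x] F′ → IntegralPoly F′ → IntegralPoly g → pcomp F g ≡ₚ[x] pcomp F′ g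
  pcomp-congˡₚ []      []        g F≡F′ iF′ ig i = ≡ₚ-refl
  pcomp-congˡₚ (a ∷ F) []        g F≡F′ iF′ ig   =
    divisiblePoly⇒≡ₚ[x]0 (pcomp (a ∷ F) g) (divisiblePoly-pcomp (a ∷ F) g (≡ₚ[x]0⇒divisiblePoly (a ∷ F) F≡F′) ig)
  pcomp-congˡₚ []      (a′ ∷ F′) g F≡F′ iF′ ig i =
    ≡ₚ-sym (divisiblePoly⇒≡ₚ[x]0 (pcomp (a′ ∷ F′) g)
             (divisiblePoly-pcomp (a′ ∷ F′) g (≡ₚ[x]0⇒divisiblePoly (a′ ∷ F′) (≡ₚ-sym ∘ F≡F′)) ig) i)
  pcomp-congˡₚ (a ∷ F) (a′ ∷ F′) g F≡F′ iF′ ig   =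
    padd-congₚ (pconst a) (pconst a′) (pmul g (pcomp F g)) (pmul g (pcomp F′ g)) const≡
      (pmul-congʳₚ g (pcomp F g) (pcomp F′ g) ig (pcomp-congˡₚ F F′ g (F≡F′ ∘ suc) (iF′ ∘ suc) ig)
                   (integralPoly-pcomp F′ g (iF′ ∘ suc) ig))
    where
    const≡ : pconst a ≡ₚ[x] pconst a′
    const≡ zero    = F≡F′ 0
    const≡ (suc i) = ≡ₚ-refl

  pcomp-congʳₚ : ∀ F g g′ → IntegralPoly F → g ≡ₚ[x] g′ → IntegralPoly g′ → pcomp F g ≡ₚ[x] pcomp F g′
  pcomp-congʳₚ []      g g′ iF g≡g′ ig′ i = ≡ₚ-refl
  pcomp-congʳₚ (a ∷ F) g g′ iF g≡g′ ig′ =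
    padd-congₚ (pconst a) (pconst a) (pmul g (pcomp F g)) (pmul g′ (pcomp F g′)) (λ _ → ≡ₚ-refl)
      (λ i → ≡ₚ-trans (pmul-congˡₚ g g′ (pcomp F g) g≡g′ ig′ (integralPoly-pcomp F g (iF ∘ suc) ig) i)
                      (pmul-congʳₚ g′ (pcomp F g) (pcomp F g′) ig′ (pcomp-congʳₚ F g g′ (iF ∘ suc) g≡g′ ig′)
                                   (integralPoly-pcomp F g′ (iF ∘ suc) ig′) i))
    where
    ig : IntegralPoly g
    ig i = integral-resp-≡ₚ (g≡g′ i) (ig′ i)

  module _ {A B : ℚ} {N-1 : ℕ} (a : ℚ) where
    open BinomialPoly A B N-1
    open Power a

    -- C(pᵏ, j) ≡ 0 (mod p) for 0 < j < pᵏ, and coefficients off the multiples of N vanish.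
    divisible-coeff-power : ∀ k q → q ≡ p ^ k → Integral a → Integral A → Integral B →
      ∀ i → 0 ℕ.< i → i ℕ.< q ℕ.* N → Divisible (coeff (power q) i)
    divisible-coeff-power k q q≡p^k ia iA iB i 0<i i<qN =
      subst (λ i → Divisible (coeff (power q) i)) (sym i≡r+jN)
            (at (i ℕDM.% N) (i ℕDM./ N) (ℕDM.m%n<n i N) (subst (0 ℕ.<_) i≡r+jN 0<i) (subst (ℕ._< q ℕ.* N) i≡r+jN i<qN))
      where
      i≡r+jN : i ≡ i ℕDM.% N ℕ.+ (i ℕDM./ N) ℕ.* N
      i≡r+jN = ℕDM.m≡m%n+[m/n]*n i N
      at : ∀ r j → r ℕ.< N → 0 ℕ.< r ℕ.+ j ℕ.* N → r ℕ.+ j ℕ.* N ℕ.< q ℕ.* N →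
           Divisible (coeff (power q) (r ℕ.+ j ℕ.* N))
      at (suc r) j       r<N _ _ = subst Divisible (sym (coeff-power-off q j (suc r) (s≤s z≤n) r<N)) divisible-0
      at zero    zero    _   () _
      at zero    (suc j) _   _ jN<qN =
        subst (λ k → Divisible (coeff (power k) (suc j ℕ.* N))) (sym q≡j+l)
              (subst Divisible (sym (coeff-power-jN (suc j) (suc l)))
                     (divisible-*ˡ (divisible-toℚ (p∣binom k j l (trans (sym q≡j+l) q≡p^k)))
                                   (integral-* ia (integral-* (integral-^ (suc j) iA) (integral-^ (suc l) iB)))))
        where
        1+j<q : suc j ℕ.< q
        1+j<q = ℕP.*-cancelʳ-< N (suc j) q jN<qN
        l : ℕ
        l = q ℕ.∸ suc (suc j)
        q≡j+l : q ≡ suc j ℕ.+ suc l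
        q≡j+l = sym (trans (ℕP.+-suc (suc j) l) (ℕP.m+[n∸m]≡n 1+j<q))

  -- g ≡ A xᴺ + B (mod p) with integral coefficients and A a p-adic unit.
  record NearBinomial (g : Poly) (N : ℕ) : Set where
    field
      integralPoly       : IntegralPoly g
      degLE              : DegLE g N
      ¬divisible-leading : ¬ Divisible (coeff g N)
      divisible-middle   : ∀ i → 0 ℕ.< i → i ℕ.< N → Divisible (coeff g i)

  divisible⇒nearBinomial-pType : ∀ {g N} → NearBinomial g N → Divisible (coeff g 0) → PType p g
  divisible⇒nearBinomial-pType {g} {N} nb dB =
    N , (leading≢0 , degLE) , integral∧¬divisible⇒val0 (integralPoly N) ¬divisible-leading , lower
    where
    open NearBinomial nb
    leading≢0 : ¬ coeff g N ≡ 0ℚ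
    leading≢0 leading≡0 = ¬divisible-leading (subst Divisible (sym leading≡0) divisible-0)
    lower : ∀ i → i ℕ.< N → ValGE p (+ 1) (coeff g i)
    lower zero    _   = divisible⇒valGE1 dB
    lower (suc i) i<N = divisible⇒valGE1 (divisible-middle (suc i) (s≤s z≤n) i<N)

  nearBinomial-pType⇒divisible : ∀ {g N} → 0 ℕ.< N → NearBinomial g N → PType p g → Divisible (coeff g 0)
  nearBinomial-pType⇒divisible {g} {N} 0<N nb (d , (leading≢0 , g≤d) , _ , lower) with ℕ.<-cmp d N
  ... | tri< d<N _ _ = ⊥-elim (NearBinomial.¬divisible-leading nb (subst Divisible (sym (g≤d N d<N)) divisible-0))
  ... | tri≈ _ refl _ = valGE1⇒divisible (lower 0 0<N)
  ... | tri> _ _ N<d = ⊥-elim (leading≢0 (NearBinomial.degLE nb d N<d))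

  module Composite {a b : ℚ} {f : Poly} (k q-1 : ℕ) (1+q-1≡p^k : suc q-1 ≡ p ^ k)
              (ia : Integral a) (¬da : ¬ Divisible a) (ib : Integral b) (if : IntegralPoly f)
              (f≡ₚF : f ≡ₚ[x] (b ∷ pmono a q-1)) (f-degLE : DegLE f (suc q-1)) (f-leading : coeff f (suc q-1) ≡ a)
              {g : Poly} {N-1 : ℕ} (g-nearBinomial : NearBinomial g (suc N-1))
              where

    open NearBinomial g-nearBinomial
    open BinomialPoly (coeff g (suc N-1)) (coeff g 0) N-1
    open Power a

    private
      q : ℕ
      q = suc q-1

      F : Poly
      F = b ∷ pmono a q-1

      integralPoly-F : IntegralPoly F
      integralPoly-F zero    = ib
      integralPoly-F (suc i) = integralPoly-pmono q-1 ia i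

      integralPoly-G : IntegralPoly G
      integralPoly-G = integralPoly-padd (pconst _) (pmono _ N) (integralPoly-pconst (integralPoly 0))
                                         (integralPoly-pmono N (integralPoly N))

      g≡ₚG : g ≡ₚ[x] G
      g≡ₚG zero    = ≡ₚ-resp-≡ refl coeff-G₀ ≡ₚ-refl
      g≡ₚG (suc i) with ℕ.<-cmp (suc i) N
      ... | tri< i<N _ _ =
        ≡ₚ-resp-≡ refl (coeff-G-middle (suc i) (s≤s z≤n) i<N) (divisible⇒≡ₚ0 (divisible-middle (suc i) (s≤s z≤n) i<N))
      ... | tri≈ _ refl _ = ≡ₚ-resp-≡ refl coeff-G-N ≡ₚ-refl
      ... | tri> _ _ N<i = ≡ₚ-resp-≡ (degLE (suc i) N<i) (G-degLE (suc i) N<i) ≡ₚ-refl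

      f∘g≡ₚF∘G : pcomp f g ≡ₚ[x] pcomp F G
      f∘g≡ₚF∘G i = ≡ₚ-trans (pcomp-congˡₚ f F g f≡ₚF integralPoly-F integralPoly i)
                            (pcomp-congʳₚ F g G integralPoly-F g≡ₚG integralPoly-G i)

      leading : DegLE (pcomp f g) (q ℕ.* N) × coeff (pcomp f g) (q ℕ.* N) ≡ coeff f q * coeff g N ^ℚ q
      leading = pcomp-degLE f q g N-1 f-degLE degLE

    pcomp-nearBinomial : NearBinomial (pcomp f g) (q ℕ.* N)
    pcomp-nearBinomial = record
      { integralPoly       = integralPoly-pcomp f g if integralPoly
      ; degLE              = proj₁ leading
      ; ¬divisible-leading = λ d → ¬divisible-* ¬da (¬divisible-^ q ¬divisible-leading)
                                     (subst Divisible (trans (proj₂ leading) (cong (_* coeff g N ^ℚ q) f-leading)) d)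
      ; divisible-middle   = middle
      }
      where
      middle : ∀ i → 0 ℕ.< i → i ℕ.< q ℕ.* N → Divisible (coeff (pcomp f g) i)
      middle (suc i) 0<i i<qN =
        divisible-resp-≡ₚ (f∘g≡ₚF∘G (suc i))
          (subst Divisible (sym (trans (coeff-pcomp-suc b (pmono a q-1) G i) (sym (coeff-power-suc q-1 (suc i)))))
                 (divisible-coeff-power a k q 1+q-1≡p^k ia (integralPoly N) (integralPoly 0) (suc i) 0<i i<qN))

    -- Fermat turns the constant term a B^q + b of f(B + A x^N) into a B + b.
    coeff-pcomp₀-≡ₚ : coeff (pcomp f g) 0 ≡ₚ a * coeff g 0 + b
    coeff-pcomp₀-≡ₚ = begin
      coeff (pcomp f g) 0                                  ≈⟨ f∘g≡ₚF∘G 0 ⟩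
      coeff (pcomp F G) 0                                  ≡⟨ coeff-pcomp₀ b (pmono a q-1) G ⟩
      b + coeff (pmul G (power q-1)) 0                     ≡⟨ cong (λ z → b + z) (sym (coeff-power-suc q-1 0)) ⟩
      b + coeff (power q) 0                                ≡⟨ cong (λ z → b + z) (coeff-power-jN 0 q) ⟩
      b + toℚ 1 * (a * (1ℚ * coeff g 0 ^ℚ q))              ≡⟨ simplify b a (coeff g 0 ^ℚ q) ⟩
      a * coeff g 0 ^ℚ q + b                               ≈⟨ +-congₚ (*-congₚ ia (integral-^ q (integralPoly 0)) ≡ₚ-refl B^q≡B) ≡ₚ-refl ⟩
      a * coeff g 0 + b                                    ∎
      where
      open ≡ₚ-Reasoning
      simplify : ∀ b a y → b + (1ℚ + 0ℚ) * (a * (1ℚ * y)) ≡ a * y + b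
      simplify = solve-∀ ℚ-ring
      B^q≡B : coeff g 0 ^ℚ q ≡ₚ coeff g 0
      B^q≡B = subst (λ n → coeff g 0 ^ℚ n ≡ₚ coeff g 0) (sym 1+q-1≡p^k) (fermat-p^k k (integralPoly 0))

-- Iterates of f

module Iterates {p : ℕ} (p-prime : Prime p) (m : ℕ) {a b : ℚ} {h : Poly}
                   (va : Val p a (+ 0)) (vb : Val p b (+ 0))
                   (h-deg : DegLT h (p ^ m)) (h-integral : PolyValGE p (+ 0) h) where

  open ModP p-prime

  private instance
    p≢0 : ℕ.NonZero p
    p≢0 = prime⇒nonZero p-prime

  q : ℕ
  q = p ^ m

  f : Poly
  f = fPoly p m a h b

  private
    ia : Integral a
    ia = val0⇒integral va

    ¬da : ¬ Divisible a
    ¬da = val0⇒¬divisible va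

    ib : Integral b
    ib = val0⇒integral vb

    ¬db : ¬ Divisible b
    ¬db = val0⇒¬divisible vb

    p/1 : ℚ
    p/1 = (+ p) / 1

    divisible-p/1 : Divisible p/1
    divisible-p/1 = Fraction.divisible-fraction p/1 (ℚP.↥-/ (+ p) 1) (ℚP.↧-/ (+ p) 1) ℕD.∣-refl p∤1

    q-1 : ℕ
    q-1 = q ℕ.∸ 1

    1+[q-1]≡q : suc q-1 ≡ q
    1+[q-1]≡q = ℕP.m+[n∸m]≡n (ℕP.m^n>0 p m)

    coeff-f : ∀ i → coeff f i ≡ coeff (pmono a q) i + (p/1 * coeff h i + coeff (pconst b) i)
    coeff-f i = trans (coeff-padd (pmono a q) _ i)
                      (cong (λ z → coeff (pmono a q) i + z)
                            (trans (coeff-padd (pscale p/1 h) (pconst b) i) (cong (λ z → z + coeff (pconst b) i) (coeff-pscale p/1 h i))))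

    divisible-ph : ∀ i → Divisible (p/1 * coeff h i)
    divisible-ph i = divisible-*ˡ divisible-p/1 (valGE0⇒integral (h-integral i))

    f≡ₚa[x^q]+b : f ≡ₚ[x] (b ∷ pmono a q-1)
    f≡ₚa[x^q]+b i = ≡ₚ-resp-≡ (trans (coeff-f i) (cong (λ k → coeff (pmono a k) i + _) (sym 1+[q-1]≡q))) (sym (target i))
                              (drop (coeff (pmono a (suc q-1)) i) (coeff (pconst b) i) (divisible-ph i))
      where
      drop : ∀ x z {y} → Divisible y → x + (y + z) ≡ₚ x + z
      drop x z {y} dy = ≡ₚ-intro (subst Divisible (sym (cancel x y z)) dy)
        where
        cancel : ∀ x y z → (x + (y + z)) - (x + z) ≡ y
        cancel = solve-∀ ℚ-ring
      target : ∀ i → coeff (pmono a (suc q-1)) i + coeff (pconst b) i ≡ coeff (b ∷ pmono a q-1) i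
      target zero    = ℚP.+-identityˡ b
      target (suc i) = ℚP.+-identityʳ (coeff (pmono a q-1) i)

    f-degLE : DegLE f q
    f-degLE i q<i = begin
      coeff f i                                               ≡⟨ coeff-f i ⟩
      coeff (pmono a q) i + (p/1 * coeff h i + coeff (pconst b) i)
        ≡⟨ cong₂ (λ u v → u + (p/1 * v + coeff (pconst b) i)) (pmono-degLE a q i q<i) (h-deg i (ℕP.<⇒≤ q<i)) ⟩
      0ℚ + (p/1 * 0ℚ + coeff (pconst b) i)                    ≡⟨ cong (λ z → 0ℚ + (p/1 * 0ℚ + z)) (pconst-vanishes i q<i) ⟩
      0ℚ + (p/1 * 0ℚ + 0ℚ)                                    ≡⟨ vanish p/1 ⟩
      0ℚ                                                      ∎
      where
      open ≡-Reasoning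
      pconst-vanishes : ∀ i → q ℕ.< i → coeff (pconst b) i ≡ 0ℚ
      pconst-vanishes (suc i) _ = refl
      vanish : ∀ x → 0ℚ + (x * 0ℚ + 0ℚ) ≡ 0ℚ
      vanish = solve-∀ ℚ-ring

    f-leading : coeff f q ≡ a
    f-leading = begin
      coeff f q                                               ≡⟨ coeff-f q ⟩
      coeff (pmono a q) q + (p/1 * coeff h q + coeff (pconst b) q)
        ≡⟨ cong₂ (λ u v → u + (p/1 * v + coeff (pconst b) q)) (coeff-pmono-≡ a q) (h-deg q ℕP.≤-refl) ⟩
      a + (p/1 * 0ℚ + coeff (pconst b) q)                     ≡⟨ cong (λ k → a + (p/1 * 0ℚ + coeff (pconst b) k)) (sym 1+[q-1]≡q) ⟩
      a + (p/1 * 0ℚ + 0ℚ)                                     ≡⟨ vanish a p/1 ⟩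
      a                                                       ∎
      where
      open ≡-Reasoning
      vanish : ∀ a x → a + (x * 0ℚ + 0ℚ) ≡ a
      vanish = solve-∀ ℚ-ring

    integralPoly-f : IntegralPoly f
    integralPoly-f i = subst Integral (sym (coeff-f i))
      (integral-+ (integralPoly-pmono q ia i) (integral-+ (divisible⇒integral (divisible-ph i)) (integralPoly-pconst ib i)))

    module Composite-f {g} {N-1} =
      Composite {a} {b} {f} m q-1 1+[q-1]≡q ia ¬da ib integralPoly-f f≡ₚa[x^q]+b
                (subst (DegLE f) (sym 1+[q-1]≡q) f-degLE) (subst (λ k → coeff f k ≡ a) (sym 1+[q-1]≡q) f-leading) {g} {N-1}

    f∘-nearBinomial : ∀ {g N} → 0 ℕ.< N → NearBinomial g N →
      NearBinomial (pcomp f g) (q ℕ.* N) × coeff (pcomp f g) 0 ≡ₚ a * coeff g 0 + b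
    f∘-nearBinomial {g} {suc N-1} _ nb =
      subst (NearBinomial (pcomp f g)) (cong (ℕ._* suc N-1) 1+[q-1]≡q) (Composite-f.pcomp-nearBinomial nb) ,
      Composite-f.coeff-pcomp₀-≡ₚ nb

    0<q^n : ∀ n → 0 ℕ.< q ^ n
    0<q^n = ℕP.m^n>0 q {{ℕP.m^n≢0 p m}}

  piter-nearBinomial : ∀ n → NearBinomial (piter n f) (q ^ n)
  piter-nearBinomial zero = record
    { integralPoly       = λ { zero → integral-0 ; (suc zero) → integral-1 ; (suc (suc i)) → integral-0 }
    ; degLE              = λ { (suc zero) (s≤s ()) ; (suc (suc i)) _ → refl }
    ; ¬divisible-leading = ¬divisible-1
    ; divisible-middle   = λ { (suc i) _ (s≤s ()) }
    }
  piter-nearBinomial (suc n) = proj₁ (f∘-nearBinomial (0<q^n n) (piter-nearBinomial n))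

  const : ℕ → ℚ
  const n = coeff (piter n f) 0

  const-suc : ∀ n → const (suc n) ≡ₚ a * const n + b
  const-suc n = proj₂ (f∘-nearBinomial (0<q^n n) (piter-nearBinomial n))

  const≡ₚb*geom : ∀ n → const n ≡ₚ b * geom a n
  const≡ₚb*geom zero    = ≡ₚ-reflexive (sym (ℚP.*-zeroʳ b))
  const≡ₚb*geom (suc n) = begin
    const (suc n)            ≈⟨ const-suc n ⟩
    a * const n + b          ≈⟨ +-congₚ (*-congₚ ia integral-const ≡ₚ-refl (const≡ₚb*geom n)) ≡ₚ-refl ⟩
    a * (b * geom a n) + b   ≡⟨ factor a b (geom a n) ⟩
    b * geom a (suc n)       ∎
    where
    open ≡ₚ-Reasoning
    integral-const : Integral (const n)
    integral-const = NearBinomial.integralPoly (piter-nearBinomial n) 0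
    factor : ∀ a b g → a * (b * g) + b ≡ b * (1ℚ + a * g)
    factor = solve-∀ ℚ-ring

  pType⇒divisible-geom : ∀ n → PType p (piter n f) → Divisible (geom a n)
  pType⇒divisible-geom n t =
    divisible-*-cancelʳ (subst Divisible (ℚP.*-comm b (geom a n)) (divisible-resp-≡ₚ (≡ₚ-sym (const≡ₚb*geom n)) dconst)) ¬db
    where
    dconst : Divisible (const n)
    dconst = nearBinomial-pType⇒divisible (0<q^n n) (piter-nearBinomial n) t

  divisible-geom⇒pType : ∀ n → Divisible (geom a n) → PType p (piter n f)
  divisible-geom⇒pType n d =
    divisible⇒nearBinomial-pType (piter-nearBinomial n) (divisible-resp-≡ₚ (const≡ₚb*geom n) (divisible-*ʳ ib d))

  case-a≡1 : a ≡ₚ 1ℚ → IsLeastPTypeIter p f p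
  case-a≡1 a≡1 = 1<p , divisible-geom⇒pType p (divisible-resp-≡ₚ (geom-≡ₚ-toℚ a≡1 p) (divisible-toℚ ℕD.∣-refl)) , below
    where
    below : ∀ j → 1 ℕ.< j → j ℕ.< p → ¬ PType p (piter j f)
    below (suc j) _ j<p t = ℕP.<⇒≱ j<p (ℕD.∣⇒≤ (divisible-toℚ⁻¹ divisible-1+j))
      where
      divisible-1+j : Divisible (toℚ (suc j))
      divisible-1+j = divisible-resp-≡ₚ (≡ₚ-sym (geom-≡ₚ-toℚ a≡1 (suc j))) (pType⇒divisible-geom (suc j) t)

  case-a≢1 : ¬ a ≡ₚ 1ℚ → ∃[ k ] (IsOrd p a k × IsLeastPTypeIter p f k)
  case-a≢1 a≢1 = k , (1≤k , ≡ₚ⇒congModP a^k≡1 , λ j 1≤j j<k c → a^j≢1 j 1≤j j<k (congModP⇒≡ₚ c))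
                   , 1<k , divisible-geom⇒pType k (^≡ₚ1⇒divisible-geom k a≢1 a^k≡1)
                   , λ j 1<j j<k t → a^j≢1 j (ℕP.<⇒≤ 1<j) j<k (divisible-geom⇒^≡ₚ1 j ia (pType⇒divisible-geom j t))
    where
    a^?≡ₚ1 : Decidable (λ n → a ^ℚ n ≡ₚ 1ℚ)
    a^?≡ₚ1 n = map′ ≡ₚ-intro divisible-diff (divisible? (a ^ℚ n - 1ℚ))
    order : ∃ (LeastPositive a^?≡ₚ1)
    order = leastPositive a^?≡ₚ1 (ℕP.∸-monoˡ-≤ 1 1<p) (fermat-unit ia ¬da)
    k : ℕ
    k = proj₁ order
    1≤k : 1 ≤ k
    1≤k = proj₁ (proj₂ order)
    a^k≡1 : a ^ℚ k ≡ₚ 1ℚ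
    a^k≡1 = proj₁ (proj₂ (proj₂ order))
    a^j≢1 : ∀ j → 1 ≤ j → j ℕ.< k → ¬ a ^ℚ j ≡ₚ 1ℚ
    a^j≢1 = proj₂ (proj₂ (proj₂ order))
    1<k : 1 ℕ.< k
    1<k = ℕP.≤∧≢⇒< 1≤k λ 1≡k →
      a≢1 (≡ₚ-trans (≡ₚ-reflexive (sym (ℚP.*-identityʳ a))) (subst (λ n → a ^ℚ n ≡ₚ 1ℚ) (sym 1≡k) a^k≡1))

proposition2p8 : (p m : ℕ) → Prime p → 1 ≤ m
    → (a b : ℚ) → (h : Poly)
    → Val p a (+ 0) → Val p b (+ 0)
    → DegLT h (p ^ m) → PolyValGE p (+ 0) h
    → EventuallyPType p (fPoly p m a h b)
    → (CongModP p a 1ℚ → IsLeastPTypeIter p (fPoly p m a h b) p)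
      × (¬ CongModP p a 1ℚ → ∃[ k ] (IsOrd p a k × IsLeastPTypeIter p (fPoly p m a h b) k))
proposition2p8 p m p-prime _ a b h va vb h-deg h-integral _ =
  case-a≡1 ∘ congModP⇒≡ₚ , λ a≢1 → case-a≢1 (a≢1 ∘ ≡ₚ⇒congModP)
  where
  open ModP p-prime
  open Iterates p-prime m {a} {b} {h} va vb h-deg h-integral
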